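{- Let $\mathcal S=(+,+,+,\dots)$ be the sequence of all elementary foldings up. Let $\sigma$ denote the positive unit triangle $T_0$ centered at $O$ with all three sides red. Then for every $n\ge0$, the edge-colored triangle $F_P^n(\sigma)$ (which is the positive triangle $4^nT_0$ of side $4^n$ centered at $O$) coincides with $P_{\mathcal S}$ on all unit edges contained in $4^nT_0$; thus the substitution rule $F_P$ with seed $\sigma$ centered at the origin generates the pattern $P_{\mathcal S}$. Correspondingly, the tile substitution $F_T$ with the seed consisting of the positive tile with three red sides centered at the origin generates the decorated folding tiling $T_{\mathcal S}$.
   Context: Grid: let $\xi_1=(0,-2\sqrt3)$ and let $\xi_2,\xi_3$ be its counterclockwise rotations by $2\pi/3$ and $4\pi/3$. For $i\in\{1,2,3\}$, $n\in\mathbb Z$ put $\ell_{i,n}=\{x\in\mathbb R^2:(x,\xi_i)=3n+1\}$. The union $\mathcal L$ of all $\ell_{i,n}$ is a triangular grid whose smallest triangles (unit triangles) are regular of side $1$; unit edges are the sides of unit triangles. A regular triangle is positive if its vertex opposite its horizontal side lies above that side, negative otherwise. $O$ is the origin and $T_0$ is the positive unit triangle centered at $O$; $\lambda T_0$ denotes the image of $T_0$ under the homothety with center $O$ and ratio $\lambda$. Folding patterns: an elementary folding folds a paper regular triangle of side $2a$ along its three midsegments onto its central triangle of side $a$; it is a folding up ($+$) if all three folds go through the upper half-space of $\mathbb R^3$ and a folding down ($-$) if all go through the lower half-space. When unfolded, fold lines of a folding up become valleys and those of a folding down become peaks. For a finite sequence $(a_1,\dots,a_k)$ take the paper triangle $(-2)^kT_0$,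 perform $a_k$ first (onto $(-2)^{k-1}T_0$), then $a_{k-1}$, …, finally $a_1$ (onto $T_0$), then unfold; valleys are colored red and peaks blue. For an infinite sequence $\mathcal S=(a_i)_{i\ge1}$, $P_{\mathcal S}$ is the red/blue coloring of all unit edges of $\mathcal L$ in which each edge gets its color from the pattern of $(a_1,\dots,a_k)$ for any $k$ with the edge interior to $(-2)^kT_0$. The decorated folding tiling $T_{\mathcal S}$ is the tiling by the unit triangles of $\mathcal L$, each tile labeled by its orientation and its edge coloring in $P_{\mathcal S}$ (number of red sides plus, when this is $1$ or $2$, a mark on the side whose color differs from the other two). Substitutions: an edge-colored triangle is a regular triangle $\Delta$ of integer side $m$, subdivided into $m^2$ unit triangles by lines parallel to its sides, with each unit edge colored red or blue. The substitution $F_+$ maps it to the edge-colored triangle $2\Delta$ (homothety of ratio $2$ centered at the center of $\Delta$; same orientation, side $2m$), where each unit triangle $\tau$ of $\Delta$ becomes the triangle $2\tau$ of side $2$, subdivided into four unit triangles (three corner ones of the orientation of $\tau$ and a central one of the opposite orientation), colored as follows: each unit edge $e$ of $\Delta$ becomes a segment of length $2$ whose two unit edges both receive the color opposite to that of $e$; the three interior unit edges of $2\tau$ (its midsegments) are colored blue if $\tau$ is positive and red if $\tau$ is negative. The substitution $F_P$ is $F_+\circ F_+$ (inflation factor $4$). The tile substitution $F_T$ is the same rule expressed on decorated tiles: a tile is replaced by the $16$ decorated tiles read off from the $F_P$-image of the corresponding edge-colored unit triangle. -}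

module Defs where

open import Data.Nat as ℕ using (ℕ; zero; suc)
open import Data.Integer as ℤ using (ℤ; +_; _-_; -_)
open import Data.Integer.Properties using (_≟_; _<?_)
open import Data.Bool using (Bool; true; false; not; if_then_else_; _∨_)
open import Data.Maybe using (Maybe; just; nothing)
open import Data.Product using (_×_; _,_)
open import Relation.Nullary.Decidable using (⌊_⌋)

data Color : Set where
  red blue : Color

opp : Color → Color
opp red  = blue
opp blue = red

-- elementary folding up (+) or down (-)
data Sign : Set where
  plus minus : Sign

data Orient : Set where
  positive negative : Orient

flipO : Orient → Orient
flipO positive = negative
flipO negative = positive

-- A point x is described by u = ((x,ξ₁),(x,ξ₂),(x,ξ₃)) (so u₁+u₂+u₃ = 0);
-- the grid lines are u_i ≡ 1 (mod 3) and λT₀ = {u : u_i/λ ≤ 1 for all i}.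
-- The grid vertices are exactly the points
--   vert p q = (1+3p , 1+3q , -2-3p-3q),  p q : ℤ.
-- Every unit edge of 𝓛 is uniquely  (p , q , d)  : the segment from
-- vert p q to vert (p+δp) (q+δq) with (δp,δq) = (1,0), (0,1), (1,-1)
-- for d = X, Y, Z respectively.

Pt : Set
Pt = ℤ × ℤ × ℤ

vert : ℤ → ℤ → Pt
vert p q = (+ 1 ℤ.+ + 3 ℤ.* p) , (+ 1 ℤ.+ + 3 ℤ.* q) , (- (+ 2) - + 3 ℤ.* p - + 3 ℤ.* q)

data Dir : Set where
  X Y Z : Dir

record Edge : Set where
  constructor edge
  field
    px  : ℤ
    py  : ℤ
    dir : Dir

endpoint₂ : Edge → Pt
endpoint₂ (edge p q X) = vert (p ℤ.+ + 1) q
endpoint₂ (edge p q Y) = vert p (q ℤ.+ + 1)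
endpoint₂ (edge p q Z) = vert (p ℤ.+ + 1) (q - + 1)

_⊕_ : Pt → Pt → Pt
(a , b , c) ⊕ (a' , b' , c') = (a ℤ.+ a') , (b ℤ.+ b') , (c ℤ.+ c')

-- doubled midpoint (sum of the u-coordinates of the two endpoints)
mid : Edge → Pt
mid e@(edge p q _) = vert p q ⊕ endpoint₂ e

negTwo^ : ℕ → ℤ
negTwo^ zero    = + 1
negTwo^ (suc k) = - (+ 2) ℤ.* negTwo^ k

-- e is interior to (-2)^k T₀ : its midpoint is strictly inside,
-- i.e. (2s - M_i)·s > 0 for all i, where s = (-2)^k, M = doubled midpoint.
Interior : ℕ → Edge → Set
Interior k e with mid e
... | (x , y , z) =
  let s = negTwo^ k ; S = + 2 ℤ.* s in
  (+ 0 ℤ.< (S - x) ℤ.* s) × (+ 0 ℤ.< (S - y) ℤ.* s) × (+ 0 ℤ.< (S - z) ℤ.* s)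

-- Folding patterns.
-- Reflections (in doubled coordinates) across the line M_i = L:
--   M_i ↦ 2L - M_i ,  M_j ↦ M_j + (M_i - L)  (j ≠ i).

refl₁ refl₂ refl₃ : ℤ → Pt → Pt
refl₁ L (x , y , z) = (+ 2 ℤ.* L - x) , (y ℤ.+ (x - L)) , (z ℤ.+ (x - L))
refl₂ L (x , y , z) = (x ℤ.+ (y - L)) , (+ 2 ℤ.* L - y) , (z ℤ.+ (y - L))
refl₃ L (x , y , z) = (x ℤ.+ (z - L)) , (y ℤ.+ (z - L)) , (+ 2 ℤ.* L - z)

-- Color of a crease made by a folding of sign a in a layer whose current
-- orientation is flipped (flipped = true) or not w.r.t. the original
-- position: valley (red) iff the layer faces up and the fold is up, or the
-- layer is flipped and the fold is down.
creaseColor : Sign → Bool → Color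
creaseColor plus  false = red
creaseColor plus  true  = blue
creaseColor minus false = blue
creaseColor minus true  = red

-- foldColor a j flipped M : the paper point with (doubled) current position
-- M lies in the folded stack (-2)^j T₀; the remaining foldings are
-- a_j, a_{j-1}, …, a_1 (a_i = a i; the value a 0 is never used).
-- The folding a_j folds (-2)^j T₀ onto (-2)^{j-1} T₀ along its midsegments
-- u_i = t, t = (-2)^{j-1}; the corner at vertex i is {(u_i - t)·t > 0}
-- and is mapped onto the central triangle by reflection in u_i = t.
foldColor : (ℕ → Sign) → ℕ → Bool → Pt → Maybe Color
foldColor a zero    fl M = nothing
foldColor a (suc j) fl (x , y , z) =
  let t = negTwo^ j ; L = + 2 ℤ.* t in
  if ⌊ x ≟ L ⌋ ∨ ⌊ y ≟ L ⌋ ∨ ⌊ z ≟ L ⌋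
  then just (creaseColor (a (suc j)) fl)
  else (if ⌊ + 0 <? (x - L) ℤ.* t ⌋
        then foldColor a j (not fl) (refl₁ L (x , y , z))
        else (if ⌊ + 0 <? (y - L) ℤ.* t ⌋
              then foldColor a j (not fl) (refl₂ L (x , y , z))
              else (if ⌊ + 0 <? (z - L) ℤ.* t ⌋
                    then foldColor a j (not fl) (refl₃ L (x , y , z))
                    else foldColor a j fl (x , y , z))))

-- The folding pattern of (a_1,…,a_k): color of the unit edge e
-- (nothing if e is not a crease).
foldingPattern : (ℕ → Sign) → ℕ → Edge → Maybe Color
foldingPattern a k e = foldColor a k false (mid e)

allUp : ℕ → Sign
allUp _ = plus

-- A triangle Δ of side m: vertices (a,b) ∈ ℕ², a+b ≤ m (position
-- corner + a·e₁ + b·e₂).  Unit edges: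
--   A a b : (a,b)–(a+1,b),  B a b : (a,b)–(a,b+1),  C a b : (a+1,b)–(a,b+1),
-- all lying in Δ iff a + b < m.  Unit triangles: up a b = (a,b),(a+1,b),(a,b+1)
-- (orientation of Δ) and down a b = (a+1,b),(a,b+1),(a+1,b+1) (opposite).
-- A coloring assigns colors to all (A|B|C) a b; values with a+b ≥ m are
-- irrelevant.

data EType : Set where
  A B C : EType

Coloring : Set
Coloring = EType → ℕ → ℕ → Color

InTri : ℕ → ℕ → ℕ → Set
InTri m a b = a ℕ.+ b ℕ.< m

half : ℕ → ℕ
half zero          = zero
half (suc zero)    = zero
half (suc (suc n)) = suc (half n)

even : ℕ → Bool
even zero          = true
even (suc zero)    = false
even (suc (suc n)) = even n

-- color of the midsegments of 2τ for a unit triangle τ of orientation o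
midColor : Orient → Color
midColor positive = blue
midColor negative = red

-- The substitution F₊ on an edge-colored triangle of orientation o
-- (homothety of ratio 2 about the center: intrinsic coordinates double).
Fplus : Orient → Coloring → Coloring
Fplus o c A a b = if even b then opp (c A (half a) (half b))
                  else (if even a then midColor o else midColor (flipO o))
Fplus o c B a b = if even a then opp (c B (half a) (half b))
                  else (if even b then midColor o else midColor (flipO o))
Fplus o c C a b = if even (a ℕ.+ b)
                  then (if even a then midColor o else midColor (flipO o))
                  else opp (c C (half a) (half b))

-- F_P = F₊ ∘ F₊ (orientation is preserved by F₊)
FP : Orient → Coloring → Coloring
FP o c = Fplus o (Fplus o c)

σ : Coloring
σ _ _ _ = red

FPⁿσ : ℕ → Coloring
FPⁿσ zero    = σ
FPⁿσ (suc n) = FP positive (FPⁿσ n)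

-- Placement of F_P^n(σ) (positive, side 4^n, centered at O) as 4^n T₀.
-- 4^n T₀ = {u_i ≤ 4^n}; with r = (4^n - 1)/3 its vertices are vert p q with
-- p ≤ r, q ≤ r, p + q ≥ -(r+1); intrinsic vertex (a,b) sits at vert (r-a) (r-b)
-- (corner (a,b) = (0,0) ↦ u = (4^n,4^n,-2·4^n)).

r : ℕ → ℤ
r zero    = + 0
r (suc n) = + 4 ℤ.* r n ℤ.+ + 1

place : ℕ → EType → ℕ → ℕ → Edge
place n A a b = edge (r n - + a - + 1) (r n - + b) X
place n B a b = edge (r n - + a) (r n - + b - + 1) Y
place n C a b = edge (r n - + a - + 1) (r n - + b) Z

-- Work in doubled coordinates (u₁, u₂, u₃), u₁ + u₂ + u₃ = 0, where the stack (-2)^(j+1) T₀ is folded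
-- onto (-2)^j T₀ along the crease lines u_i = 2(-2)^j. Multiplication by -2 conjugates each folding
-- with the next one, so a point -2M + d with a small displacement d has the folding history of M, one
-- level later, as long as no step brings it onto a crease; residues modulo 6 certify this for edge
-- midpoints and for centres of unit triangles. A unit edge of the subdivided (-2)^(j+1) T₀ is either
-- half of a unit edge of (-2)^j T₀, and then keeps its colour, or a midsegment of a doubled unit
-- triangle τ; in the second case the centre of τ is folded onto the centre of T₀, and the last folding
-- puts the midsegment on a crease whose colour depends only on the orientation of τ. So j foldings up
-- colour (-2)^j T₀ by the j-th iterate of c ↦ opp (F₊ c), and two iterates make F_P. Points strictly
-- inside (-2)^j T₀ are moved by none of the later foldings, so the colour of an edge does not depend
-- on the number of foldings performed.

module Submission where

open import Defs
open import Data.Nat using (ℕ; _^_)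
open import Data.Maybe using (just)
open import Relation.Binary.PropositionalEquality using (_≡_)

open import Data.Nat as ℕ using (zero; suc; z≤n; s≤s)
import Data.Nat.Properties as ℕₚ
import Data.Nat.Tactic.RingSolver as ℕ-Solver
open import Data.Integer using (ℤ; +_; -[1+_]; +[1+_]; 0ℤ; _+_; _*_; _-_; -_; _<_; +<+; -<+)
import Data.Integer.Properties as ℤₚ
open import Data.Integer.Tactic.RingSolver using (solve-∀)
open import Data.Bool using (Bool; true; false; not; T; if_then_else_; _∨_)
import Data.Bool.Properties as Boolₚ
open import Data.Maybe using (Maybe)
open import Data.Product using (Σ; _×_; _,_; proj₁; proj₂)
open import Data.Sum using (_⊎_; inj₁; inj₂)
open import Data.Empty using (⊥-elim)
open import Relation.Nullary using (¬_)
open import Relation.Nullary.Decidable using (Dec; yes; no; ⌊_⌋)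
open import Relation.Binary using (tri<; tri≈; tri>)
open import Relation.Binary.PropositionalEquality using (_≢_; refl; sym; trans; cong; cong₂; subst; subst₂; module ≡-Reasoning)

⌊⌋-true : ∀ {A : Set} (a? : Dec A) → A → ⌊ a? ⌋ ≡ true
⌊⌋-true (yes _) _ = refl
⌊⌋-true (no ¬a) a = ⊥-elim (¬a a)

⌊⌋-false : ∀ {A : Set} (a? : Dec A) → ¬ A → ⌊ a? ⌋ ≡ false
⌊⌋-false (yes a) ¬a = ⊥-elim (¬a a)
⌊⌋-false (no _) _ = refl

⌊⌋-true⁻¹ : ∀ {A : Set} (a? : Dec A) → ⌊ a? ⌋ ≡ true → A
⌊⌋-true⁻¹ (yes a) _ = a

⌊⌋-false⁻¹ : ∀ {A : Set} (a? : Dec A) → ⌊ a? ⌋ ≡ false → ¬ A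
⌊⌋-false⁻¹ (no ¬a) _ = ¬a

⌊⌋-⇔ : ∀ {A B : Set} (a? : Dec A) (b? : Dec B) → (A → B) → (B → A) → ⌊ a? ⌋ ≡ ⌊ b? ⌋
⌊⌋-⇔ (yes a) b? to _ = sym (⌊⌋-true b? (to a))
⌊⌋-⇔ (no ¬a) b? _ from = sym (⌊⌋-false b? (λ b → ¬a (from b)))

<-lit : ∀ m n → {T (m ℕ.<ᵇ n)} → m ℕ.< n
<-lit m n {m<n} = ℕₚ.<ᵇ⇒< m n m<n

pos*pos : ∀ {i j} → 0ℤ < i → 0ℤ < j → 0ℤ < i * j
pos*pos {+[1+ m ]} {+[1+ n ]} _ _ = +<+ (s≤s z≤n)
pos*pos {+ zero} (+<+ ()) _
pos*pos {j = + zero} _ (+<+ ())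

neg*neg : ∀ {i j} → i < 0ℤ → j < 0ℤ → 0ℤ < i * j
neg*neg { -[1+ m ]} { -[1+ n ]} _ _ = +<+ (s≤s z≤n)
neg*neg {+ m} (+<+ ()) _
neg*neg { -[1+ m ]} {+ n} _ (+<+ ())

data SameSign (i j : ℤ) : Set where
  both-pos : 0ℤ < i → 0ℤ < j → SameSign i j
  both-neg : i < 0ℤ → j < 0ℤ → SameSign i j

0<*⇒SameSign : ∀ i j → 0ℤ < i * j → SameSign i j
0<*⇒SameSign i (+ zero) i*0>0 = ⊥-elim (ℤₚ.<-irrefl refl (subst (0ℤ <_) (ℤₚ.*-zeroʳ i) i*0>0))
0<*⇒SameSign (+ zero) j (+<+ ())
0<*⇒SameSign +[1+ m ] +[1+ n ] _ = both-pos (+<+ (s≤s z≤n)) (+<+ (s≤s z≤n))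
0<*⇒SameSign -[1+ m ] -[1+ n ] _ = both-neg -<+ -<+
0<*⇒SameSign +[1+ m ] -[1+ n ] ()
0<*⇒SameSign -[1+ m ] +[1+ n ] ()

SameSign⇒0<* : ∀ {i j} → SameSign i j → 0ℤ < i * j
SameSign⇒0<* (both-pos i>0 j>0) = pos*pos i>0 j>0
SameSign⇒0<* (both-neg i<0 j<0) = neg*neg i<0 j<0

SameSign-trans : ∀ {i j k} → SameSign i j → SameSign i k → SameSign j k
SameSign-trans (both-pos _ j>0) (both-pos _ k>0) = both-pos j>0 k>0
SameSign-trans (both-neg _ j<0) (both-neg _ k<0) = both-neg j<0 k<0
SameSign-trans (both-pos i>0 _) (both-neg i<0 _) = ⊥-elim (ℤₚ.<-asym i>0 i<0)
SameSign-trans (both-neg i<0 _) (both-pos i>0 _) = ⊥-elim (ℤₚ.<-asym i>0 i<0)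

SameSign-sym : ∀ {i j} → SameSign i j → SameSign j i
SameSign-sym (both-pos i>0 j>0) = both-pos j>0 i>0
SameSign-sym (both-neg i<0 j<0) = both-neg j<0 i<0

⌊0<*⌋-SameSign : ∀ {i j} k → SameSign i j → ⌊ 0ℤ ℤₚ.<? i * k ⌋ ≡ ⌊ 0ℤ ℤₚ.<? j * k ⌋
⌊0<*⌋-SameSign {i} {j} k s = ⌊⌋-⇔ (0ℤ ℤₚ.<? i * k) (0ℤ ℤₚ.<? j * k) (transfer s) (transfer (SameSign-sym s))
  where
  transfer : ∀ {i j} → SameSign i j → 0ℤ < i * k → 0ℤ < j * k
  transfer {i} s i*k>0 = SameSign⇒0<* (SameSign-trans s (0<*⇒SameSign i k i*k>0))

⌊0<suc*⌋ : ∀ n i → ⌊ 0ℤ ℤₚ.<? + suc n * i ⌋ ≡ ⌊ 0ℤ ℤₚ.<? i ⌋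
⌊0<suc*⌋ n i = ⌊⌋-⇔ (0ℤ ℤₚ.<? + suc n * i) (0ℤ ℤₚ.<? i) cancel (pos*pos {+ suc n} (+<+ (s≤s z≤n)))
  where
  cancel : 0ℤ < + suc n * i → 0ℤ < i
  cancel h with 0<*⇒SameSign (+ suc n) i h
  ... | both-pos _ i>0 = i>0
  ... | both-neg (+<+ ()) _

affine-pos : ∀ a c n → 0ℤ < + a * + n + + suc c
affine-pos a c n rewrite sym (ℤₚ.pos-* a n) = +<+ (ℕₚ.≤-trans (s≤s z≤n) (ℕₚ.m≤n+m (suc c) (a ℕ.* n)))

affine-neg : ∀ a c n → c ℕ.< a → + a * -[1+ n ] + + c < 0ℤ
affine-neg a c n c<a = subst (_< 0ℤ) (sym a*k≡) (subst (- + (a ℕ.* suc n) + + c <_) (ℤₚ.+-inverseˡ (+ (a ℕ.* suc n)))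
  (ℤₚ.+-monoʳ-< (- + (a ℕ.* suc n)) (+<+ (ℕₚ.<-≤-trans c<a (ℕₚ.m≤m*n a (suc n))))))
  where
  a*k≡ : + a * -[1+ n ] + + c ≡ - + (a ℕ.* suc n) + + c
  a*k≡ = cong (_+ + c) (trans (sym (ℤₚ.neg-distribʳ-* (+ a) (+ suc n))) (cong -_ (sym (ℤₚ.pos-* a (suc n)))))

affine-SameSign : ∀ a c a′ c′ k → suc c ℕ.< a → suc c′ ℕ.< a′ →
                  SameSign (+ a * k + + suc c) (+ a′ * k + + suc c′)
affine-SameSign a c a′ c′ (+ n) _ _ = both-pos (affine-pos a c n) (affine-pos a′ c′ n)
affine-SameSign a c a′ c′ -[1+ n ] c<a c′<a′ = both-neg (affine-neg a (suc c) n c<a) (affine-neg a′ (suc c′) n c′<a′)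

affine≢0 : ∀ a c k → suc c ℕ.< a → + a * k + + suc c ≢ 0ℤ
affine≢0 a c (+ n) _ eq = ℤₚ.<-irrefl refl (subst (0ℤ <_) eq (affine-pos a c n))
affine≢0 a c -[1+ n ] c<a eq = ℤₚ.<-irrefl refl (subst (_< 0ℤ) eq (affine-neg a (suc c) n c<a))

infix 4 _≡_[mod_]
_≡_[mod_] : ℤ → ℤ → ℕ → Set
x ≡ r [mod q ] = Σ ℤ λ m → x ≡ + q * m + r

-2*-≡1[mod3] : ∀ {t} → t ≡ + 1 [mod 3 ] → - + 2 * t ≡ + 1 [mod 3 ]
-2*-≡1[mod3] (m , refl) = - + 2 * m - + 1 , identity m
  where
  identity : ∀ m → - + 2 * (+ 3 * m + + 1) ≡ + 3 * (- + 2 * m - + 1) + + 1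
  identity = solve-∀

negTwo^≡1[mod3] : ∀ j → negTwo^ j ≡ + 1 [mod 3 ]
negTwo^≡1[mod3] zero = 0ℤ , refl
negTwo^≡1[mod3] (suc j) = -2*-≡1[mod3] (negTwo^≡1[mod3] j)

negTwo^≢0 : ∀ j → negTwo^ j ≢ 0ℤ
negTwo^≢0 j with negTwo^≡1[mod3] j
... | m , t≡ = λ t≡0 → affine≢0 3 0 m (<-lit 1 3) (trans (sym t≡) t≡0)

≡⇒-≡0 : ∀ {a b} → a ≡ b → a - b ≡ 0ℤ
≡⇒-≡0 {a} refl = ℤₚ.+-inverseʳ a

sum-swap : ∀ x y z → x + y + z ≡ 0ℤ → y + x + z ≡ 0ℤ
sum-swap x y z sum≡0 = trans (swap x y z) sum≡0
  where
  swap : ∀ x y z → y + x + z ≡ x + y + z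
  swap = solve-∀

sum-rotate : ∀ x y z → x + y + z ≡ 0ℤ → y + z + x ≡ 0ℤ
sum-rotate x y z sum≡0 = trans (rotate x y z) sum≡0
  where
  rotate : ∀ x y z → y + z + x ≡ x + y + z
  rotate = solve-∀

<⇒0<- : ∀ {i j} → i < j → 0ℤ < j - i
<⇒0<- {i} {j} i<j = subst (_< j - i) (ℤₚ.+-inverseʳ i) (ℤₚ.+-monoˡ-< (- i) i<j)

6*+<6* : ∀ u c M → u ℕ.< M → c ℕ.< 6 → + 6 * + u + + c < + 6 * + M
6*+<6* u c M u<M c<6 = subst₂ _<_ (cong (_+ + c) (ℤₚ.pos-* 6 u)) (ℤₚ.pos-* 6 M) (+<+ bound)
  where
  bound : 6 ℕ.* u ℕ.+ c ℕ.< 6 ℕ.* M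
  bound = ℕₚ.<-≤-trans (ℕₚ.+-monoʳ-< (6 ℕ.* u) c<6)
            (subst (ℕ._≤ 6 ℕ.* M) (trans (ℕₚ.*-suc 6 u) (ℕₚ.+-comm 6 (6 ℕ.* u))) (ℕₚ.*-monoʳ-≤ 6 u<M))

onCrease : ℤ → ℤ → Bool
onCrease t x = ⌊ x ℤₚ.≟ + 2 * t ⌋

beyondCrease : ℤ → ℤ → Bool
beyondCrease t x = ⌊ 0ℤ ℤₚ.<? (x - + 2 * t) * t ⌋

foldStep : (onAny beyond₁ beyond₂ beyond₃ : Bool) (onFold reflected₁ reflected₂ reflected₃ kept : Maybe Color) →
           Maybe Color
foldStep onAny b₁ b₂ b₃ v v₁ v₂ v₃ v₀ =
  if onAny then v else if b₁ then v₁ else if b₂ then v₂ else if b₃ then v₃ else v₀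

foldColor-suc : ∀ j fl x y z → foldColor allUp (suc j) fl (x , y , z) ≡
  let t = negTwo^ j in
  foldStep (onCrease t x ∨ onCrease t y ∨ onCrease t z) (beyondCrease t x) (beyondCrease t y) (beyondCrease t z)
    (just (creaseColor plus fl))
    (foldColor allUp j (not fl) (refl₁ (+ 2 * t) (x , y , z)))
    (foldColor allUp j (not fl) (refl₂ (+ 2 * t) (x , y , z)))
    (foldColor allUp j (not fl) (refl₃ (+ 2 * t) (x , y , z)))
    (foldColor allUp j fl (x , y , z))
foldColor-suc _ _ _ _ _ = refl

foldStep-cong : ∀ {o b₁ b₂ b₃ o′ b₁′ b₂′ b₃′} {v v₁ v₂ v₃ v₀} → o ≡ o′ → b₁ ≡ b₁′ → b₂ ≡ b₂′ → b₃ ≡ b₃′ →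
                foldStep o b₁ b₂ b₃ v v₁ v₂ v₃ v₀ ≡ foldStep o′ b₁′ b₂′ b₃′ v v₁ v₂ v₃ v₀
foldStep-cong refl refl refl refl = refl

InPlane : Pt → Set
InPlane (x , y , z) = x + y + z ≡ 0ℤ

Inside : ℤ → Pt → Set
Inside s (x , y , z) = (0ℤ < (+ 2 * s - x) * s) × (0ℤ < (+ 2 * s - y) * s) × (0ℤ < (+ 2 * s - z) * s)

inside⇒¬onCrease : ∀ s x → 0ℤ < (+ 2 * s - x) * s → onCrease s x ≡ false
inside⇒¬onCrease s x inside = ⌊⌋-false (x ℤₚ.≟ + 2 * s) on
  where
  on : x ≢ + 2 * s
  on refl = ℤₚ.<-irrefl refl (subst (0ℤ <_) (zero-offset s) inside)
    where
    zero-offset : ∀ s → (+ 2 * s - + 2 * s) * s ≡ 0ℤ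
    zero-offset = solve-∀

inside⇒¬beyondCrease : ∀ s x → 0ℤ < (+ 2 * s - x) * s → beyondCrease s x ≡ false
inside⇒¬beyondCrease s x inside =
  ⌊⌋-false (0ℤ ℤₚ.<? (x - + 2 * s) * s) (ℤₚ.<-asym (subst (_< 0ℤ) (flip s x) (ℤₚ.neg-mono-< inside)))
  where
  flip : ∀ s x → - ((+ 2 * s - x) * s) ≡ (x - + 2 * s) * s
  flip = solve-∀

foldColor-inside : ∀ j fl M → Inside (negTwo^ j) M → foldColor allUp (suc j) fl M ≡ foldColor allUp j fl M
foldColor-inside j fl (x , y , z) (x-in , y-in , z-in) =
  trans (foldColor-suc j fl x y z)
        (foldStep-cong (∨-false³ (inside⇒¬onCrease _ x x-in) (inside⇒¬onCrease _ y y-in) (inside⇒¬onCrease _ z z-in))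
                       (inside⇒¬beyondCrease _ x x-in) (inside⇒¬beyondCrease _ y y-in) (inside⇒¬beyondCrease _ z z-in))
  where
  ∨-false³ : ∀ {a b c : Bool} → a ≡ false → b ≡ false → c ≡ false → a ∨ b ∨ c ≡ false
  ∨-false³ refl refl refl = refl

-- The slack of a coordinate in (-2s)T₀ is twice the sum of the slacks of the other two in sT₀.
Inside-double : ∀ s M → InPlane M → Inside s M → Inside (- + 2 * s) M
Inside-double s (x , y , z) x+y+z≡0 (x-in , y-in , z-in) =
  slack x y z x+y+z≡0 y-in z-in ,
  slack y x z (sum-swap x y z x+y+z≡0) x-in z-in ,
  slack z x y (sum-rotate y z x (sum-rotate x y z x+y+z≡0)) x-in y-in
  where
  slack : ∀ x y z → x + y + z ≡ 0ℤ → 0ℤ < (+ 2 * s - y) * s → 0ℤ < (+ 2 * s - z) * s →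
          0ℤ < (+ 2 * (- + 2 * s) - x) * (- + 2 * s)
  slack x y z sum≡0 y-in z-in = subst (0ℤ <_) (sym split) (pos*pos {+ 2} (+<+ (s≤s z≤n)) (ℤₚ.+-mono-< y-in z-in))
    where
    identity : ∀ s x y z → (+ 2 * (- + 2 * s) - x) * (- + 2 * s) ≡
                           + 2 * ((+ 2 * s - y) * s + (+ 2 * s - z) * s) + + 2 * ((x + y + z) * s)
    identity = solve-∀
    split : (+ 2 * (- + 2 * s) - x) * (- + 2 * s) ≡ + 2 * ((+ 2 * s - y) * s + (+ 2 * s - z) * s)
    split = trans (identity s x y z)
                  (trans (cong (λ v → + 2 * ((+ 2 * s - y) * s + (+ 2 * s - z) * s) + + 2 * (v * s)) sum≡0)
                         (ℤₚ.+-identityʳ _))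

Inside-negTwo^ : ∀ d j M → InPlane M → Inside (negTwo^ j) M → Inside (negTwo^ (d ℕ.+ j)) M
Inside-negTwo^ zero j M _ inside = inside
Inside-negTwo^ (suc d) j M inPlane inside = Inside-double (negTwo^ (d ℕ.+ j)) M inPlane (Inside-negTwo^ d j M inPlane inside)

foldColor-inside⁺ : ∀ d j fl M → InPlane M → Inside (negTwo^ j) M →
                    foldColor allUp (d ℕ.+ j) fl M ≡ foldColor allUp j fl M
foldColor-inside⁺ zero j fl M _ _ = refl
foldColor-inside⁺ (suc d) j fl M inPlane inside =
  trans (foldColor-inside (d ℕ.+ j) fl M (Inside-negTwo^ d j M inPlane inside))
        (foldColor-inside⁺ d j fl M inPlane inside)

foldColor-inside-≤ : ∀ {j k} fl M → j ℕ.≤ k → InPlane M → Inside (negTwo^ j) M →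
                     foldColor allUp k fl M ≡ foldColor allUp j fl M
foldColor-inside-≤ {j} fl M j≤k inPlane inside with ℕₚ.m≤n⇒∃[o]m+o≡n j≤k
... | d , refl rewrite ℕₚ.+-comm j d = foldColor-inside⁺ d j fl M inPlane inside

foldColor-stable : ∀ j k fl M → InPlane M → Inside (negTwo^ j) M → Inside (negTwo^ k) M →
                   foldColor allUp j fl M ≡ foldColor allUp k fl M
foldColor-stable j k fl M inPlane j-in k-in with ℕₚ.≤-total j k
... | inj₁ j≤k = sym (foldColor-inside-≤ fl M j≤k inPlane j-in)
... | inj₂ k≤j = foldColor-inside-≤ fl M k≤j inPlane k-in

TestsAgree : ℤ → ℤ → ℤ → Set
TestsAgree t x x′ = (onCrease (- + 2 * t) x′ ≡ onCrease t x) × (beyondCrease (- + 2 * t) x′ ≡ beyondCrease t x)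

OffCrease : ℤ → ℤ → ℤ → Set
OffCrease t x x′ = (onCrease (- + 2 * t) x′ ≡ false) × (onCrease t x ≡ false) × (beyondCrease (- + 2 * t) x′ ≡ beyondCrease t x)

OffCrease⇒TestsAgree : ∀ {t x x′} → OffCrease t x x′ → TestsAgree t x x′
OffCrease⇒TestsAgree (new-off , old-off , beyond) = trans new-off (sym old-off) , beyond

rescaled-exact : ∀ t x → TestsAgree t x (- + 2 * x + 0ℤ)
rescaled-exact t x =
  ⌊⌋-⇔ (_ ℤₚ.≟ _) (x ℤₚ.≟ + 2 * t) halve double ,
  trans (cong (λ v → ⌊ 0ℤ ℤₚ.<? v ⌋) (scaled t x)) (⌊0<suc*⌋ 3 _)
  where
  halve : - + 2 * x + 0ℤ ≡ + 2 * (- + 2 * t) → x ≡ + 2 * t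
  halve eq = ℤₚ.*-cancelˡ-≡ (- + 2) x (+ 2 * t) (trans (sym (ℤₚ.+-identityʳ _)) (trans eq (commute t)))
    where
    commute : ∀ t → + 2 * (- + 2 * t) ≡ - + 2 * (+ 2 * t)
    commute = solve-∀
  double : x ≡ + 2 * t → - + 2 * x + 0ℤ ≡ + 2 * (- + 2 * t)
  double refl = commute t
    where
    commute : ∀ t → - + 2 * (+ 2 * t) + 0ℤ ≡ + 2 * (- + 2 * t)
    commute = solve-∀
  scaled : ∀ t x → ((- + 2 * x + 0ℤ) - + 2 * (- + 2 * t)) * (- + 2 * t) ≡ + 4 * ((x - + 2 * t) * t)
  scaled = solve-∀

-- A coordinate x at offset 6k + c + 1 from the crease line 2t is moved by x ↦ -2x + d to offset
-- -(12k + e + 1) from the next crease line 2(-2t): for 0 < c + 1 < 6 and 0 < e + 1 < 12 neither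
-- offset vanishes, and 6k + c + 1 and 12k + e + 1 have the same sign.
rescaled-off-crease : ∀ t x d q c e → t ≡ + 1 [mod 3 ] → x ≡ + 2 + + 6 * q + + suc c [mod 6 ] →
  d ≡ + 2 * + suc c - + suc e → c ℕ.< 5 → e ℕ.< 11 → OffCrease t x (- + 2 * x + d)
rescaled-off-crease t x d q c e (m₀ , refl) (m , refl) refl c<5 e<11 =
  ⌊⌋-false (_ ℤₚ.≟ _)
    (λ eq → affine≢0 12 e k (s≤s e<11) (ℤₚ.neg-injective (trans (sym (new-offset m₀ m q c⁺ e⁺)) (≡⇒-≡0 eq)))) ,
  ⌊⌋-false (_ ℤₚ.≟ _) (λ eq → affine≢0 6 c k (s≤s c<5) (trans (sym (old-offset m₀ m q c⁺)) (≡⇒-≡0 eq))) ,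
  (begin
    ⌊ 0ℤ ℤₚ.<? ((- + 2 * x′ + d′) - + 2 * (- + 2 * t′)) * (- + 2 * t′) ⌋
      ≡⟨ cong (λ v → ⌊ 0ℤ ℤₚ.<? v ⌋) (new-test m₀ m q c⁺ e⁺) ⟩
    ⌊ 0ℤ ℤₚ.<? + 2 * ((+ 12 * k + e⁺) * t′) ⌋
      ≡⟨ ⌊0<suc*⌋ 1 _ ⟩
    ⌊ 0ℤ ℤₚ.<? (+ 12 * k + e⁺) * t′ ⌋
      ≡⟨ ⌊0<*⌋-SameSign t′ (affine-SameSign 12 e 6 c k (s≤s e<11) (s≤s c<5)) ⟩
    ⌊ 0ℤ ℤₚ.<? (+ 6 * k + c⁺) * t′ ⌋
      ≡⟨ cong (λ v → ⌊ 0ℤ ℤₚ.<? v * t′ ⌋) (sym (old-offset m₀ m q c⁺)) ⟩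
    ⌊ 0ℤ ℤₚ.<? (x′ - + 2 * t′) * t′ ⌋ ∎)
  where
  open ≡-Reasoning
  c⁺ = + suc c
  e⁺ = + suc e
  k = m - m₀ + q
  t′ = + 3 * m₀ + + 1
  x′ = + 6 * m + (+ 2 + + 6 * q + c⁺)
  d′ = + 2 * c⁺ - e⁺
  new-offset : ∀ m₀ m q c⁺ e⁺ →
               (- + 2 * (+ 6 * m + (+ 2 + + 6 * q + c⁺)) + (+ 2 * c⁺ - e⁺)) - + 2 * (- + 2 * (+ 3 * m₀ + + 1))
                              ≡ - (+ 12 * (m - m₀ + q) + e⁺)
  new-offset = solve-∀
  old-offset : ∀ m₀ m q c⁺ → (+ 6 * m + (+ 2 + + 6 * q + c⁺)) - + 2 * (+ 3 * m₀ + + 1) ≡ + 6 * (m - m₀ + q) + c⁺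
  old-offset = solve-∀
  new-test : ∀ m₀ m q c⁺ e⁺ →
             ((- + 2 * (+ 6 * m + (+ 2 + + 6 * q + c⁺)) + (+ 2 * c⁺ - e⁺)) - + 2 * (- + 2 * (+ 3 * m₀ + + 1)))
                            * (- + 2 * (+ 3 * m₀ + + 1)) ≡ + 2 * ((+ 12 * (m - m₀ + q) + e⁺) * (+ 3 * m₀ + + 1))
  new-test = solve-∀

rescale : Pt → Pt → Pt
rescale (x , y , z) (dx , dy , dz) = (- + 2 * x + dx) , (- + 2 * y + dy) , (- + 2 * z + dz)

triple-≡ : ∀ {a b c a′ b′ c′ : ℤ} → a ≡ a′ → b ≡ b′ → c ≡ c′ → (a , b , c) ≡ (a′ , b′ , c′)
triple-≡ refl refl refl = refl

private
  reflected-rescaled : ∀ t x dx → + 2 * (+ 2 * (- + 2 * t)) - (- + 2 * x + dx) ≡ - + 2 * (+ 2 * (+ 2 * t) - x) + (+ 2 * 0ℤ - dx)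
  reflected-rescaled = solve-∀

  shifted-rescaled : ∀ t x y dx dy → (- + 2 * y + dy) + ((- + 2 * x + dx) - + 2 * (- + 2 * t)) ≡
                                     - + 2 * (y + (x - + 2 * t)) + (dy + (dx - 0ℤ))
  shifted-rescaled = solve-∀

refl₁-rescale : ∀ t P d → refl₁ (+ 2 * (- + 2 * t)) (rescale P d) ≡ rescale (refl₁ (+ 2 * t) P) (refl₁ 0ℤ d)
refl₁-rescale t (x , y , z) (dx , dy , dz) =
  triple-≡ (reflected-rescaled t x dx) (shifted-rescaled t x y dx dy) (shifted-rescaled t x z dx dz)

refl₂-rescale : ∀ t P d → refl₂ (+ 2 * (- + 2 * t)) (rescale P d) ≡ rescale (refl₂ (+ 2 * t) P) (refl₂ 0ℤ d)
refl₂-rescale t (x , y , z) (dx , dy , dz) =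
  triple-≡ (shifted-rescaled t y x dy dx) (reflected-rescaled t y dy) (shifted-rescaled t y z dy dz)

refl₃-rescale : ∀ t P d → refl₃ (+ 2 * (- + 2 * t)) (rescale P d) ≡ rescale (refl₃ (+ 2 * t) P) (refl₃ 0ℤ d)
refl₃-rescale t (x , y , z) (dx , dy , dz) =
  triple-≡ (shifted-rescaled t z x dz dx) (shifted-rescaled t z y dz dy) (reflected-rescaled t z dz)

reflect-InPlane : ∀ L x y z → x + y + z ≡ 0ℤ → (+ 2 * L - x) + (y + (x - L)) + (z + (x - L)) ≡ 0ℤ
reflect-InPlane L x y z sum≡0 = trans (identity L x y z) sum≡0
  where
  identity : ∀ L x y z → (+ 2 * L - x) + (y + (x - L)) + (z + (x - L)) ≡ x + y + z
  identity = solve-∀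

refl₁-InPlane : ∀ L P → InPlane P → InPlane (refl₁ L P)
refl₁-InPlane L (x , y , z) = reflect-InPlane L x y z

refl₂-InPlane : ∀ L P → InPlane P → InPlane (refl₂ L P)
refl₂-InPlane L (x , y , z) sum≡0 =
  sum-swap (+ 2 * L - y) (x + (y - L)) (z + (y - L)) (reflect-InPlane L y x z (sum-swap x y z sum≡0))

refl₃-InPlane : ∀ L P → InPlane P → InPlane (refl₃ L P)
refl₃-InPlane L (x , y , z) sum≡0 =
  sum-rotate (+ 2 * L - z) (x + (z - L)) (y + (z - L)) (reflect-InPlane L z x y (sum-rotate y z x (sum-rotate x y z sum≡0)))

-- A doubled coordinate of an edge midpoint lies either on a grid line (≡ 2 mod 6) or halfway
-- between two (≡ 5 mod 6); halving the edge shifts the rescaled coordinate by 0, resp. ±3.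
data EdgeShift (x d : ℤ) : Set where
  on-line  : x ≡ + 2 [mod 6 ] → d ≡ 0ℤ → EdgeShift x d
  off-line : x ≡ + 5 [mod 6 ] → d ≡ + 3 ⊎ d ≡ - + 3 → EdgeShift x d

EdgeShifts : Pt → Pt → Set
EdgeShifts P@(x , y , z) d@(dx , dy , dz) =
  EdgeShift x dx × EdgeShift y dy × EdgeShift z dz × InPlane P × InPlane d

EdgeShift-tests : ∀ {t x d} → t ≡ + 1 [mod 3 ] → EdgeShift x d → TestsAgree t x (- + 2 * x + d)
EdgeShift-tests {t} {x} _ (on-line _ refl) = rescaled-exact t x
EdgeShift-tests {t} {x} t≡ (off-line x≡ (inj₁ refl)) =
  OffCrease⇒TestsAgree (rescaled-off-crease t x (+ 3) 0ℤ 2 2 t≡ x≡ refl (<-lit 2 5) (<-lit 2 11))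
EdgeShift-tests {t} {x} t≡ (off-line x≡ (inj₂ refl)) =
  OffCrease⇒TestsAgree (rescaled-off-crease t x (- + 3) 0ℤ 2 8 t≡ x≡ refl (<-lit 2 5) (<-lit 8 11))

EdgeShift-reflect : ∀ {t x d} → t ≡ + 1 [mod 3 ] → EdgeShift x d → EdgeShift (+ 2 * (+ 2 * t) - x) (+ 2 * 0ℤ - d)
EdgeShift-reflect (m₀ , refl) (on-line (m , refl) refl) = on-line (+ 2 * m₀ - m , residue m₀ m) refl
  where
  residue : ∀ m₀ m → + 2 * (+ 2 * (+ 3 * m₀ + + 1)) - (+ 6 * m + + 2) ≡ + 6 * (+ 2 * m₀ - m) + + 2
  residue = solve-∀
EdgeShift-reflect (m₀ , refl) (off-line (m , refl) d≡) = off-line (+ 2 * m₀ - m - + 1 , residue m₀ m) (negate d≡)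
  where
  residue : ∀ m₀ m → + 2 * (+ 2 * (+ 3 * m₀ + + 1)) - (+ 6 * m + + 5) ≡ + 6 * (+ 2 * m₀ - m - + 1) + + 5
  residue = solve-∀
  negate : ∀ {d} → d ≡ + 3 ⊎ d ≡ - + 3 → + 2 * 0ℤ - d ≡ + 3 ⊎ + 2 * 0ℤ - d ≡ - + 3
  negate (inj₁ refl) = inj₂ refl
  negate (inj₂ refl) = inj₁ refl

EdgeShift-shift : ∀ {t x y z dx dy dz} → t ≡ + 1 [mod 3 ] → EdgeShift x dx → EdgeShift y dy → EdgeShift z dz →
                  x + y + z ≡ 0ℤ → dx + dy + dz ≡ 0ℤ → EdgeShift (y + (x - + 2 * t)) (dy + (dx - 0ℤ))
EdgeShift-shift (m₀ , refl) (on-line (mx , refl) refl) (on-line (my , refl) refl) _ _ _ =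
  on-line (my + mx - m₀ , residue m₀ mx my) refl
  where
  residue : ∀ m₀ mx my → (+ 6 * my + + 2) + ((+ 6 * mx + + 2) - + 2 * (+ 3 * m₀ + + 1)) ≡ + 6 * (my + mx - m₀) + + 2
  residue = solve-∀
EdgeShift-shift (m₀ , refl) (on-line (mx , refl) refl) (off-line (my , refl) dy≡) _ _ _ =
  off-line (my + mx - m₀ , residue m₀ mx my) (keep dy≡)
  where
  residue : ∀ m₀ mx my → (+ 6 * my + + 5) + ((+ 6 * mx + + 2) - + 2 * (+ 3 * m₀ + + 1)) ≡ + 6 * (my + mx - m₀) + + 5
  residue = solve-∀
  keep : ∀ {d} → d ≡ + 3 ⊎ d ≡ - + 3 → d + (0ℤ - 0ℤ) ≡ + 3 ⊎ d + (0ℤ - 0ℤ) ≡ - + 3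
  keep (inj₁ refl) = inj₁ refl
  keep (inj₂ refl) = inj₂ refl
EdgeShift-shift (m₀ , refl) (off-line (mx , refl) dx≡) (on-line (my , refl) refl) _ _ _ =
  off-line (my + mx - m₀ , residue m₀ mx my) (keep dx≡)
  where
  residue : ∀ m₀ mx my → (+ 6 * my + + 2) + ((+ 6 * mx + + 5) - + 2 * (+ 3 * m₀ + + 1)) ≡ + 6 * (my + mx - m₀) + + 5
  residue = solve-∀
  keep : ∀ {d} → d ≡ + 3 ⊎ d ≡ - + 3 → 0ℤ + (d - 0ℤ) ≡ + 3 ⊎ 0ℤ + (d - 0ℤ) ≡ - + 3
  keep (inj₁ refl) = inj₁ refl
  keep (inj₂ refl) = inj₂ refl
EdgeShift-shift _ (off-line (mx , refl) _) (off-line (my , refl) _) (off-line (mz , refl) _) sum≡0 _ =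
  ⊥-elim (affine≢0 6 2 (mx + my + mz + + 2) (<-lit 3 6) (trans (identity mx my mz) sum≡0))
  where
  identity : ∀ mx my mz → + 6 * (mx + my + mz + + 2) + + 3 ≡ (+ 6 * mx + + 5) + (+ 6 * my + + 5) + (+ 6 * mz + + 5)
  identity = solve-∀
EdgeShift-shift (m₀ , refl) (off-line (mx , refl) dx≡) (off-line (my , refl) dy≡) (on-line _ refl) _ dsum≡0 =
  on-line (my + mx - m₀ + + 1 , residue m₀ mx my) (cancel dx≡ dy≡ dsum≡0)
  where
  residue : ∀ m₀ mx my → (+ 6 * my + + 5) + ((+ 6 * mx + + 5) - + 2 * (+ 3 * m₀ + + 1)) ≡ + 6 * (my + mx - m₀ + + 1) + + 2
  residue = solve-∀
  cancel : ∀ {dx dy} → dx ≡ + 3 ⊎ dx ≡ - + 3 → dy ≡ + 3 ⊎ dy ≡ - + 3 → dx + dy + 0ℤ ≡ 0ℤ → dy + (dx - 0ℤ) ≡ 0ℤ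
  cancel (inj₁ refl) (inj₂ refl) _ = refl
  cancel (inj₂ refl) (inj₁ refl) _ = refl
  cancel (inj₁ refl) (inj₁ refl) ()
  cancel (inj₂ refl) (inj₂ refl) ()

EdgeShifts-refl₁ : ∀ {t} P d → t ≡ + 1 [mod 3 ] → EdgeShifts P d → EdgeShifts (refl₁ (+ 2 * t) P) (refl₁ 0ℤ d)
EdgeShifts-refl₁ {t} P@(x , y , z) d@(dx , dy , dz) t≡ (ex , ey , ez , s , ds) =
  EdgeShift-reflect t≡ ex ,
  EdgeShift-shift t≡ ex ey ez s ds ,
  EdgeShift-shift t≡ ex ez ey (x+z+y x y z s) (x+z+y dx dy dz ds) ,
  refl₁-InPlane (+ 2 * t) P s , refl₁-InPlane 0ℤ d ds
  where
  x+z+y : ∀ x y z → x + y + z ≡ 0ℤ → x + z + y ≡ 0ℤ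
  x+z+y x y z sum≡0 = sum-swap z x y (sum-rotate y z x (sum-rotate x y z sum≡0))

EdgeShifts-refl₂ : ∀ {t} P d → t ≡ + 1 [mod 3 ] → EdgeShifts P d → EdgeShifts (refl₂ (+ 2 * t) P) (refl₂ 0ℤ d)
EdgeShifts-refl₂ {t} P@(x , y , z) d@(dx , dy , dz) t≡ (ex , ey , ez , s , ds) =
  EdgeShift-shift t≡ ey ex ez (sum-swap x y z s) (sum-swap dx dy dz ds) ,
  EdgeShift-reflect t≡ ey ,
  EdgeShift-shift t≡ ey ez ex (sum-rotate x y z s) (sum-rotate dx dy dz ds) ,
  refl₂-InPlane (+ 2 * t) P s , refl₂-InPlane 0ℤ d ds

EdgeShifts-refl₃ : ∀ {t} P d → t ≡ + 1 [mod 3 ] → EdgeShifts P d → EdgeShifts (refl₃ (+ 2 * t) P) (refl₃ 0ℤ d)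
EdgeShifts-refl₃ {t} P@(x , y , z) d@(dx , dy , dz) t≡ (ex , ey , ez , s , ds) =
  EdgeShift-shift t≡ ez ex ey (z+x+y x y z s) (z+x+y dx dy dz ds) ,
  EdgeShift-shift t≡ ez ey ex (sum-swap y z x (sum-rotate x y z s)) (sum-swap dy dz dx (sum-rotate dx dy dz ds)) ,
  EdgeShift-reflect t≡ ez ,
  refl₃-InPlane (+ 2 * t) P s , refl₃-InPlane 0ℤ d ds
  where
  z+x+y : ∀ x y z → x + y + z ≡ 0ℤ → z + x + y ≡ 0ℤ
  z+x+y x y z sum≡0 = sum-rotate y z x (sum-rotate x y z sum≡0)

foldStep-mono : ∀ o b₁ b₂ b₃ {v v₁ v₂ v₃ v₀ w₁ w₂ w₃ w₀ : Maybe Color} {c} →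
  (w₁ ≡ just c → v₁ ≡ just c) → (w₂ ≡ just c → v₂ ≡ just c) → (w₃ ≡ just c → v₃ ≡ just c) → (w₀ ≡ just c → v₀ ≡ just c) →
  foldStep o b₁ b₂ b₃ v w₁ w₂ w₃ w₀ ≡ just c → foldStep o b₁ b₂ b₃ v v₁ v₂ v₃ v₀ ≡ just c
foldStep-mono true  _     _     _     _  _  _  _  h = h
foldStep-mono false true  _     _     f₁ _  _  _  h = f₁ h
foldStep-mono false false true  _     _  f₂ _  _  h = f₂ h
foldStep-mono false false false true  _  _  f₃ _  h = f₃ h
foldStep-mono false false false false _  _  _  f₀ h = f₀ h

foldColor-rescale : ∀ j fl P d {c} → EdgeShifts P d → foldColor allUp j fl P ≡ just c →
                    foldColor allUp (suc j) fl (rescale P d) ≡ just c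
foldColor-rescale zero fl P d _ ()
foldColor-rescale (suc j) fl P@(x , y , z) d@(dx , dy , dz) {c} shifts@(sx , sy , sz , _) colored =
  trans (foldColor-suc (suc j) fl (- + 2 * x + dx) (- + 2 * y + dy) (- + 2 * z + dz))
  (trans (foldStep-cong (cong₂ _∨_ (proj₁ tx) (cong₂ _∨_ (proj₁ ty) (proj₁ tz))) (proj₂ tx) (proj₂ ty) (proj₂ tz))
         (foldStep-mono (onCrease t x ∨ onCrease t y ∨ onCrease t z) (beyondCrease t x) (beyondCrease t y) (beyondCrease t z)
            (reflected refl₁ (refl₁-rescale t) (EdgeShifts-refl₁ P d t≡ shifts))
            (reflected refl₂ (refl₂-rescale t) (EdgeShifts-refl₂ P d t≡ shifts))
            (reflected refl₃ (refl₃-rescale t) (EdgeShifts-refl₃ P d t≡ shifts))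
            (foldColor-rescale j fl P d shifts)
            (trans (sym (foldColor-suc j fl x y z)) colored)))
  where
  t = negTwo^ j
  t≡ : t ≡ + 1 [mod 3 ]
  t≡ = negTwo^≡1[mod3] j
  tx : TestsAgree t x (- + 2 * x + dx)
  tx = EdgeShift-tests t≡ sx
  ty : TestsAgree t y (- + 2 * y + dy)
  ty = EdgeShift-tests t≡ sy
  tz : TestsAgree t z (- + 2 * z + dz)
  tz = EdgeShift-tests t≡ sz
  reflected : (R : ℤ → Pt → Pt) → (∀ P d → R (+ 2 * (- + 2 * t)) (rescale P d) ≡ rescale (R (+ 2 * t) P) (R 0ℤ d)) →
              EdgeShifts (R (+ 2 * t) P) (R 0ℤ d) → foldColor allUp j (not fl) (R (+ 2 * t) P) ≡ just c →
              foldColor allUp (suc j) (not fl) (R (+ 2 * (- + 2 * t)) (rescale P d)) ≡ just c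
  reflected R commute shifts′ colored′ =
    subst (λ Q → foldColor allUp (suc j) (not fl) Q ≡ just c) (sym (commute P d))
          (foldColor-rescale j (not fl) (R (+ 2 * t) P) (R 0ℤ d) shifts′ colored′)

-- Doubled coordinates of the centre of a positive (negative) unit triangle are ≡ 0 (≡ 4) mod 6.
centreResidue : Orient → ℤ
centreResidue positive = 0ℤ
centreResidue negative = + 4

Centre : Orient → Pt → Set
Centre o P@(x , y , z) =
  x ≡ centreResidue o [mod 6 ] × y ≡ centreResidue o [mod 6 ] × z ≡ centreResidue o [mod 6 ] × InPlane P

data Side : Set where
  side₁ side₂ side₃ : Side

long short : Orient → ℤ
long positive = + 2
long negative = - + 2
short positive = - + 1
short negative = + 1

-- If C is the centre of a unit triangle τ of orientation o, then the points -2C + midsegment o i are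
-- the midpoints of the three midsegments of -2τ.
midsegment : Orient → Side → Pt
midsegment o side₁ = long o , short o , short o
midsegment o side₂ = short o , long o , short o
midsegment o side₃ = short o , short o , long o

Component : Orient → ℤ → Set
Component o d = d ≡ long o ⊎ d ≡ short o

midsegment-components : ∀ o i → let (dx , dy , dz) = midsegment o i in Component o dx × Component o dy × Component o dz
midsegment-components o side₁ = inj₁ refl , inj₂ refl , inj₂ refl
midsegment-components o side₂ = inj₂ refl , inj₁ refl , inj₂ refl
midsegment-components o side₃ = inj₂ refl , inj₂ refl , inj₁ refl

swap₂₃ swap₁₃ swap₁₂ : Side → Side
swap₂₃ side₁ = side₁
swap₂₃ side₂ = side₃
swap₂₃ side₃ = side₂
swap₁₃ side₁ = side₃
swap₁₃ side₂ = side₂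
swap₁₃ side₃ = side₁
swap₁₂ side₁ = side₂
swap₁₂ side₂ = side₁
swap₁₂ side₃ = side₃

reflect-midsegment : ∀ o i → (refl₁ 0ℤ (midsegment o i) ≡ midsegment (flipO o) (swap₂₃ i)) ×
                             (refl₂ 0ℤ (midsegment o i) ≡ midsegment (flipO o) (swap₁₃ i)) ×
                             (refl₃ 0ℤ (midsegment o i) ≡ midsegment (flipO o) (swap₁₂ i))
reflect-midsegment positive side₁ = refl , refl , refl
reflect-midsegment positive side₂ = refl , refl , refl
reflect-midsegment positive side₃ = refl , refl , refl
reflect-midsegment negative side₁ = refl , refl , refl
reflect-midsegment negative side₂ = refl , refl , refl
reflect-midsegment negative side₃ = refl , refl , refl

-- A unit triangle reaches T₀ turned over iff it is negative.
midsegmentColor : Bool → Orient → Color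
midsegmentColor fl positive = creaseColor plus fl
midsegmentColor fl negative = creaseColor plus (not fl)

midsegmentColor-flip : ∀ fl o → midsegmentColor (not fl) (flipO o) ≡ midsegmentColor fl o
midsegmentColor-flip true positive = refl
midsegmentColor-flip false positive = refl
midsegmentColor-flip true negative = refl
midsegmentColor-flip false negative = refl

centre-tests : ∀ {t x d} o → t ≡ + 1 [mod 3 ] → x ≡ centreResidue o [mod 6 ] → Component o d →
               OffCrease t x (- + 2 * x + d)
centre-tests {t} {x} positive t≡ x≡ (inj₁ refl) = rescaled-off-crease t x (+ 2) -[1+ 0 ] 3 5 t≡ x≡ refl (<-lit 3 5) (<-lit 5 11)
centre-tests {t} {x} positive t≡ x≡ (inj₂ refl) = rescaled-off-crease t x (- + 1) -[1+ 0 ] 3 8 t≡ x≡ refl (<-lit 3 5) (<-lit 8 11)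
centre-tests {t} {x} negative t≡ x≡ (inj₁ refl) = rescaled-off-crease t x (- + 2) 0ℤ 1 5 t≡ x≡ refl (<-lit 1 5) (<-lit 5 11)
centre-tests {t} {x} negative t≡ x≡ (inj₂ refl) = rescaled-off-crease t x (+ 1) 0ℤ 1 2 t≡ x≡ refl (<-lit 1 5) (<-lit 2 11)

centre-reflect : ∀ {t x} o → t ≡ + 1 [mod 3 ] → x ≡ centreResidue o [mod 6 ] →
                 + 2 * (+ 2 * t) - x ≡ centreResidue (flipO o) [mod 6 ]
centre-reflect positive (m₀ , refl) (m , refl) = + 2 * m₀ - m , residue m₀ m
  where
  residue : ∀ m₀ m → + 2 * (+ 2 * (+ 3 * m₀ + + 1)) - (+ 6 * m + 0ℤ) ≡ + 6 * (+ 2 * m₀ - m) + + 4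
  residue = solve-∀
centre-reflect negative (m₀ , refl) (m , refl) = + 2 * m₀ - m , residue m₀ m
  where
  residue : ∀ m₀ m → + 2 * (+ 2 * (+ 3 * m₀ + + 1)) - (+ 6 * m + + 4) ≡ + 6 * (+ 2 * m₀ - m) + 0ℤ
  residue = solve-∀

centre-shift : ∀ {t x y} o → t ≡ + 1 [mod 3 ] → x ≡ centreResidue o [mod 6 ] → y ≡ centreResidue o [mod 6 ] →
               y + (x - + 2 * t) ≡ centreResidue (flipO o) [mod 6 ]
centre-shift positive (m₀ , refl) (a , refl) (b , refl) = b + a - m₀ - + 1 , residue m₀ a b
  where
  residue : ∀ m₀ a b → (+ 6 * b + 0ℤ) + ((+ 6 * a + 0ℤ) - + 2 * (+ 3 * m₀ + + 1)) ≡ + 6 * (b + a - m₀ - + 1) + + 4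
  residue = solve-∀
centre-shift negative (m₀ , refl) (a , refl) (b , refl) = b + a - m₀ + + 1 , residue m₀ a b
  where
  residue : ∀ m₀ a b → (+ 6 * b + + 4) + ((+ 6 * a + + 4) - + 2 * (+ 3 * m₀ + + 1)) ≡ + 6 * (b + a - m₀ + + 1) + 0ℤ
  residue = solve-∀

Centre-refl₁ : ∀ {t} o P → t ≡ + 1 [mod 3 ] → Centre o P → Centre (flipO o) (refl₁ (+ 2 * t) P)
Centre-refl₁ {t} o P t≡ (cx , cy , cz , s) =
  centre-reflect o t≡ cx , centre-shift o t≡ cx cy , centre-shift o t≡ cx cz , refl₁-InPlane (+ 2 * t) P s

Centre-refl₂ : ∀ {t} o P → t ≡ + 1 [mod 3 ] → Centre o P → Centre (flipO o) (refl₂ (+ 2 * t) P)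
Centre-refl₂ {t} o P t≡ (cx , cy , cz , s) =
  centre-shift o t≡ cy cx , centre-reflect o t≡ cy , centre-shift o t≡ cy cz , refl₂-InPlane (+ 2 * t) P s

Centre-refl₃ : ∀ {t} o P → t ≡ + 1 [mod 3 ] → Centre o P → Centre (flipO o) (refl₃ (+ 2 * t) P)
Centre-refl₃ {t} o P t≡ (cx , cy , cz , s) =
  centre-shift o t≡ cz cx , centre-shift o t≡ cz cy , centre-reflect o t≡ cz , refl₃-InPlane (+ 2 * t) P s

reflected-own-inside : ∀ t x → beyondCrease t x ≡ true → 0ℤ < (+ 2 * t - (+ 2 * (+ 2 * t) - x)) * t
reflected-own-inside t x beyond = subst (0ℤ <_) (identity t x) (⌊⌋-true⁻¹ (0ℤ ℤₚ.<? (x - + 2 * t) * t) beyond)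
  where
  identity : ∀ t x → (x - + 2 * t) * t ≡ (+ 2 * t - (+ 2 * (+ 2 * t) - x)) * t
  identity = solve-∀

-- After reflecting in the crease x = 2t, the slack of y in tT₀ is half the slack of z in (-2t)T₀.
reflected-other-inside : ∀ t x y z → x + y + z ≡ 0ℤ → 0ℤ < (+ 2 * (- + 2 * t) - z) * (- + 2 * t) →
                         0ℤ < (+ 2 * t - (y + (x - + 2 * t))) * t
reflected-other-inside t x y z sum≡0 z-in = subst (0ℤ <_) (sym halved) (0<2*⇒0< (subst (0ℤ <_) (doubled t z) z-in))
  where
  doubled : ∀ t z → (+ 2 * (- + 2 * t) - z) * (- + 2 * t) ≡ + 2 * ((+ 4 * t + z) * t)
  doubled = solve-∀
  identity : ∀ t x y z → (+ 2 * t - (y + (x - + 2 * t))) * t ≡ (+ 4 * t + z) * t + - ((x + y + z) * t)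
  identity = solve-∀
  halved : (+ 2 * t - (y + (x - + 2 * t))) * t ≡ (+ 4 * t + z) * t
  halved = trans (identity t x y z) (trans (cong (λ v → (+ 4 * t + z) * t + - (v * t)) sum≡0) (ℤₚ.+-identityʳ _))
  0<2*⇒0< : ∀ {i} → 0ℤ < + 2 * i → 0ℤ < i
  0<2*⇒0< {i} 2i>0 = ⌊⌋-true⁻¹ (0ℤ ℤₚ.<? i) (trans (sym (⌊0<suc*⌋ 1 i)) (⌊⌋-true (0ℤ ℤₚ.<? + 2 * i) 2i>0))

between-creases-inside : ∀ t x → t ≢ 0ℤ → onCrease t x ≡ false → beyondCrease t x ≡ false → 0ℤ < (+ 2 * t - x) * t
between-creases-inside t x t≢0 off ¬beyond with ℤₚ.<-cmp ((x - + 2 * t) * t) 0ℤ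
... | tri< neg _ _ = subst (0ℤ <_) (identity t x) (ℤₚ.neg-mono-< neg)
  where
  identity : ∀ t x → - ((x - + 2 * t) * t) ≡ (+ 2 * t - x) * t
  identity = solve-∀
... | tri> _ _ pos = ⊥-elim (⌊⌋-false⁻¹ (0ℤ ℤₚ.<? (x - + 2 * t) * t) ¬beyond pos)
... | tri≈ _ product≡0 _ with ℤₚ.i*j≡0⇒i≡0∨j≡0 (x - + 2 * t) product≡0
...   | inj₂ t≡0 = ⊥-elim (t≢0 t≡0)
...   | inj₁ x-2t≡0 =
  ⊥-elim (⌊⌋-false⁻¹ (x ℤₚ.≟ + 2 * t) off (trans (identity x (+ 2 * t)) (trans (cong (_+ + 2 * t) x-2t≡0) (ℤₚ.+-identityˡ _))))
  where
  identity : ∀ x u → x ≡ (x - u) + u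
  identity = solve-∀

Inside-refl₁ : ∀ t P → InPlane P → Inside (- + 2 * t) P → beyondCrease t (proj₁ P) ≡ true →
               Inside t (refl₁ (+ 2 * t) P)
Inside-refl₁ t (x , y , z) s (x-in , y-in , z-in) beyond =
  reflected-own-inside t x beyond ,
  reflected-other-inside t x y z s z-in ,
  reflected-other-inside t x z y (sum-swap z x y (sum-rotate y z x (sum-rotate x y z s))) y-in

Inside-refl₂ : ∀ t P → InPlane P → Inside (- + 2 * t) P → beyondCrease t (proj₁ (proj₂ P)) ≡ true →
               Inside t (refl₂ (+ 2 * t) P)
Inside-refl₂ t (x , y , z) s (x-in , y-in , z-in) beyond =
  reflected-other-inside t y x z (sum-swap x y z s) z-in ,
  reflected-own-inside t y beyond ,
  reflected-other-inside t y z x (sum-rotate x y z s) x-in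

Inside-refl₃ : ∀ t P → InPlane P → Inside (- + 2 * t) P → beyondCrease t (proj₂ (proj₂ P)) ≡ true →
               Inside t (refl₃ (+ 2 * t) P)
Inside-refl₃ t (x , y , z) s (x-in , y-in , z-in) beyond =
  reflected-other-inside t z x y (sum-rotate y z x (sum-rotate x y z s)) y-in ,
  reflected-other-inside t z y x (sum-swap y z x (sum-rotate x y z s)) x-in ,
  reflected-own-inside t z beyond

private
  NonPositive : ℤ → Set
  NonPositive a = a ≡ 0ℤ ⊎ Σ ℕ (λ n → a ≡ -[1+ n ])

  -[1+]≢0 : ∀ {n} → -[1+ n ] ≢ 0ℤ
  -[1+]≢0 ()

  positive-centre-in-T₀ : ∀ a → 0ℤ < (+ 2 * + 1 - (+ 6 * a + 0ℤ)) * + 1 → NonPositive a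
  positive-centre-in-T₀ (+ zero) _ = inj₁ refl
  positive-centre-in-T₀ -[1+ n ] _ = inj₂ (n , refl)
  positive-centre-in-T₀ +[1+ n ] a-in =
    ⊥-elim (ℤₚ.<-asym (subst (0ℤ <_) (identity +[1+ n ]) a-in) (affine-neg 6 2 n (<-lit 2 6)))
    where
    identity : ∀ a → (+ 2 * + 1 - (+ 6 * a + 0ℤ)) * + 1 ≡ + 6 * (- a) + + 2
    identity = solve-∀

  negative-centre-in-T₀ : ∀ a → 0ℤ < (+ 2 * + 1 - (+ 6 * a + + 4)) * + 1 → Σ ℕ (λ n → a ≡ -[1+ n ])
  negative-centre-in-T₀ -[1+ n ] _ = n , refl
  negative-centre-in-T₀ (+ n) a-in =
    ⊥-elim (ℤₚ.<-asym (subst (0ℤ <_) (identity (+ n)) a-in) (ℤₚ.neg-mono-< (affine-pos 6 1 n)))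
    where
    identity : ∀ a → (+ 2 * + 1 - (+ 6 * a + + 4)) * + 1 ≡ - (+ 6 * a + + 2)
    identity = solve-∀

  nonPositive-sum : ∀ {a b c} → NonPositive a → NonPositive b → NonPositive c →
                    (+ 6 * a + 0ℤ) + (+ 6 * b + 0ℤ) + (+ 6 * c + 0ℤ) ≡ 0ℤ → a ≡ 0ℤ × b ≡ 0ℤ × c ≡ 0ℤ
  nonPositive-sum (inj₁ refl) (inj₁ refl) (inj₁ refl) _ = refl , refl , refl
  nonPositive-sum (inj₁ refl) (inj₁ refl) (inj₂ (_ , refl)) sum≡0 = ⊥-elim (-[1+]≢0 sum≡0)
  nonPositive-sum (inj₁ refl) (inj₂ (_ , refl)) (inj₁ refl) sum≡0 = ⊥-elim (-[1+]≢0 sum≡0)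
  nonPositive-sum (inj₁ refl) (inj₂ (_ , refl)) (inj₂ (_ , refl)) sum≡0 = ⊥-elim (-[1+]≢0 sum≡0)
  nonPositive-sum (inj₂ (_ , refl)) (inj₁ refl) (inj₁ refl) sum≡0 = ⊥-elim (-[1+]≢0 sum≡0)
  nonPositive-sum (inj₂ (_ , refl)) (inj₁ refl) (inj₂ (_ , refl)) sum≡0 = ⊥-elim (-[1+]≢0 sum≡0)
  nonPositive-sum (inj₂ (_ , refl)) (inj₂ (_ , refl)) (inj₁ refl) sum≡0 = ⊥-elim (-[1+]≢0 sum≡0)
  nonPositive-sum (inj₂ (_ , refl)) (inj₂ (_ , refl)) (inj₂ (_ , refl)) sum≡0 = ⊥-elim (-[1+]≢0 sum≡0)

centre-in-T₀ : ∀ o P → Centre o P → Inside (+ 1) P → o ≡ positive × P ≡ (0ℤ , 0ℤ , 0ℤ)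
centre-in-T₀ positive (x , y , z) ((a , refl) , (b , refl) , (c , refl) , sum≡0) (x-in , y-in , z-in)
  with nonPositive-sum (positive-centre-in-T₀ a x-in) (positive-centre-in-T₀ b y-in) (positive-centre-in-T₀ c z-in) sum≡0
... | refl , refl , refl = refl , refl
centre-in-T₀ negative (x , y , z) ((a , refl) , (b , refl) , (c , refl) , sum≡0) (x-in , y-in , z-in)
  with negative-centre-in-T₀ a x-in | negative-centre-in-T₀ b y-in | negative-centre-in-T₀ c z-in
... | p , refl | q , refl | r , refl = ⊥-elim (-[1+]≢0 (trans (sym (identity -[1+ p ] -[1+ q ] -[1+ r ])) sum≡0))
  where
  identity : ∀ a b c → (+ 6 * a + + 4) + (+ 6 * b + + 4) + (+ 6 * c + + 4) ≡ + 6 * (a + b + c + + 2) + 0ℤ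
  identity = solve-∀

foldStep-off : ∀ b₁ b₂ b₃ {v v₁ v₂ v₃ v₀ : Maybe Color} {R} →
  (b₁ ≡ true → v₁ ≡ R) → (b₁ ≡ false → b₂ ≡ true → v₂ ≡ R) →
  (b₁ ≡ false → b₂ ≡ false → b₃ ≡ true → v₃ ≡ R) → (b₁ ≡ false → b₂ ≡ false → b₃ ≡ false → v₀ ≡ R) →
  foldStep false b₁ b₂ b₃ v v₁ v₂ v₃ v₀ ≡ R
foldStep-off true  _     _     f₁ _  _  _  = f₁ refl
foldStep-off false true  _     _  f₂ _  _  = f₂ refl refl
foldStep-off false false true  _  _  f₃ _  = f₃ refl refl refl
foldStep-off false false false _  _  _  f₀ = f₀ refl refl refl

foldColor-centre : ∀ j fl o P i → Centre o P → Inside (negTwo^ j) P →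
                   foldColor allUp (suc j) fl (rescale P (midsegment o i)) ≡ just (midsegmentColor fl o)
foldColor-centre zero fl o P i centre inside with centre-in-T₀ o P centre inside
foldColor-centre zero fl o P side₁ centre inside | refl , refl = refl
foldColor-centre zero fl o P side₂ centre inside | refl , refl = refl
foldColor-centre zero fl o P side₃ centre inside | refl , refl = refl
foldColor-centre (suc j) fl o P@(x , y , z) i centre@(cx , cy , cz , s) inside =
  trans (foldColor-suc (suc j) fl (- + 2 * x + dx) (- + 2 * y + dy) (- + 2 * z + dz))
  (trans (foldStep-cong off (proj₂ (proj₂ tx)) (proj₂ (proj₂ ty)) (proj₂ (proj₂ tz)))
         (foldStep-off (beyondCrease t x) (beyondCrease t y) (beyondCrease t z) {v = just (creaseColor plus fl)}
           (λ b → reflected refl₁ swap₂₃ (refl₁-rescale t P d) (proj₁ (reflect-midsegment o i))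
                    (Centre-refl₁ o P t≡ centre) (Inside-refl₁ t P s inside b))
           (λ _ b → reflected refl₂ swap₁₃ (refl₂-rescale t P d) (proj₁ (proj₂ (reflect-midsegment o i)))
                    (Centre-refl₂ o P t≡ centre) (Inside-refl₂ t P s inside b))
           (λ _ _ b → reflected refl₃ swap₁₂ (refl₃-rescale t P d) (proj₂ (proj₂ (reflect-midsegment o i)))
                    (Centre-refl₃ o P t≡ centre) (Inside-refl₃ t P s inside b))
           (λ bx by bz → foldColor-centre j fl o P i centre
                    (between-creases-inside t x t≢0 (proj₁ (proj₂ tx)) bx ,
                     between-creases-inside t y t≢0 (proj₁ (proj₂ ty)) by ,
                     between-creases-inside t z t≢0 (proj₁ (proj₂ tz)) bz))))
  where
  t = negTwo^ j
  t≡ : t ≡ + 1 [mod 3 ]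
  t≡ = negTwo^≡1[mod3] j
  t≢0 : t ≢ 0ℤ
  t≢0 = negTwo^≢0 j
  d = midsegment o i
  dx = proj₁ d
  dy = proj₁ (proj₂ d)
  dz = proj₂ (proj₂ d)
  components : Component o dx × Component o dy × Component o dz
  components = midsegment-components o i
  tx : OffCrease t x (- + 2 * x + dx)
  tx = centre-tests o t≡ cx (proj₁ components)
  ty : OffCrease t y (- + 2 * y + dy)
  ty = centre-tests o t≡ cy (proj₁ (proj₂ components))
  tz : OffCrease t z (- + 2 * z + dz)
  tz = centre-tests o t≡ cz (proj₂ (proj₂ components))
  off : onCrease (- + 2 * t) (- + 2 * x + dx) ∨ onCrease (- + 2 * t) (- + 2 * y + dy) ∨ onCrease (- + 2 * t) (- + 2 * z + dz) ≡ false
  off rewrite proj₁ tx | proj₁ ty | proj₁ tz = refl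
  reflected : (R : ℤ → Pt → Pt) (swap : Side → Side) →
              R (+ 2 * (- + 2 * t)) (rescale P d) ≡ rescale (R (+ 2 * t) P) (R 0ℤ d) → R 0ℤ d ≡ midsegment (flipO o) (swap i) →
              Centre (flipO o) (R (+ 2 * t) P) → Inside t (R (+ 2 * t) P) →
              foldColor allUp (suc j) (not fl) (R (+ 2 * (- + 2 * t)) (rescale P d)) ≡ just (midsegmentColor fl o)
  reflected R swap commute reflected-d centre′ inside′ =
    trans (cong (foldColor allUp (suc j) (not fl)) (trans commute (cong (rescale (R (+ 2 * t) P)) reflected-d)))
          (trans (foldColor-centre j (not fl) (flipO o) (R (+ 2 * t) P) (swap i) centre′ inside′)
                 (cong just (midsegmentColor-flip fl o)))

negOne^ : ℕ → ℤ
negOne^ zero = + 1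
negOne^ (suc j) = - negOne^ j

levelOrient : ℕ → Orient
levelOrient zero = positive
levelOrient (suc j) = flipO (levelOrient j)

level-parity : ∀ j → (negOne^ j ≡ + 1 × levelOrient j ≡ positive) ⊎ (negOne^ j ≡ - + 1 × levelOrient j ≡ negative)
level-parity zero = inj₁ (refl , refl)
level-parity (suc j) with level-parity j
... | inj₁ (e≡ , o≡) rewrite e≡ | o≡ = inj₂ (refl , refl)
... | inj₂ (e≡ , o≡) rewrite e≡ | o≡ = inj₁ (refl , refl)

negOne^≡±1 : ∀ j → negOne^ j ≡ + 1 ⊎ negOne^ j ≡ - + 1
negOne^≡±1 j with level-parity j
... | inj₁ (e≡ , _) = inj₁ e≡
... | inj₂ (e≡ , _) = inj₂ e≡

negTwo^≡negOne^*2^ : ∀ j → negTwo^ j ≡ negOne^ j * + (2 ^ j)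
negTwo^≡negOne^*2^ zero = refl
negTwo^≡negOne^*2^ (suc j) =
  trans (cong (- + 2 *_) (negTwo^≡negOne^*2^ j))
        (trans (identity (negOne^ j) (+ (2 ^ j))) (cong (λ v → - negOne^ j * v) (sym (ℤₚ.pos-* 2 (2 ^ j)))))
  where
  identity : ∀ e w → - + 2 * (e * w) ≡ - e * (+ 2 * w)
  identity = solve-∀

-- The point with intrinsic coordinates (U/6, V/6) in the triangle sT₀ whose corner (0,0) is at
-- (2s, 2s, -4s) and whose orientation is the sign e of s, in doubled coordinates.
triPoint : ℤ → ℤ → ℤ → ℤ → Pt
triPoint s e U V = (+ 2 * s - e * U) , (+ 2 * s - e * V) , (- + 4 * s + e * (U + V))

levelPoint : ℕ → ℤ → ℤ → Pt
levelPoint j = triPoint (negTwo^ j) (negOne^ j)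

edgeMidpoint : ℕ → EType → ℕ → ℕ → Pt
edgeMidpoint j A a b = levelPoint j (+ 6 * + a + + 3) (+ 6 * + b + 0ℤ)
edgeMidpoint j B a b = levelPoint j (+ 6 * + a + 0ℤ) (+ 6 * + b + + 3)
edgeMidpoint j C a b = levelPoint j (+ 6 * + a + + 3) (+ 6 * + b + + 3)

upCentre downCentre : ℕ → ℕ → ℕ → Pt
upCentre j a b = levelPoint j (+ 6 * + a + + 2) (+ 6 * + b + + 2)
downCentre j a b = levelPoint j (+ 6 * + a + + 4) (+ 6 * + b + + 4)

levelPoint-InPlane : ∀ j U V → InPlane (levelPoint j U V)
levelPoint-InPlane j U V = identity (negTwo^ j) (negOne^ j) U V
  where
  identity : ∀ s e U V → (+ 2 * s - e * U) + (+ 2 * s - e * V) + (- + 4 * s + e * (U + V)) ≡ 0ℤ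
  identity = solve-∀

edgeMidpoint-InPlane : ∀ j t a b → InPlane (edgeMidpoint j t a b)
edgeMidpoint-InPlane j A a b = levelPoint-InPlane j _ _
edgeMidpoint-InPlane j B a b = levelPoint-InPlane j _ _
edgeMidpoint-InPlane j C a b = levelPoint-InPlane j _ _

displacement : ℤ → ℤ → ℤ → Pt
displacement e u v = (e * u) , (e * v) , - (e * (u + v))

levelPoint-suc : ∀ j U V U₀ V₀ {u v} → U - + 2 * U₀ ≡ u → V - + 2 * V₀ ≡ v →
                 levelPoint (suc j) U V ≡ rescale (levelPoint j U₀ V₀) (displacement (negOne^ j) u v)
levelPoint-suc j U V U₀ V₀ refl refl =
  triple-≡ (side (negTwo^ j) (negOne^ j) U U₀) (side (negTwo^ j) (negOne^ j) V V₀)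
           (third (negTwo^ j) (negOne^ j) U V U₀ V₀)
  where
  side : ∀ s e U U₀ → + 2 * (- + 2 * s) - (- e) * U ≡ - + 2 * (+ 2 * s - e * U₀) + e * (U - + 2 * U₀)
  side = solve-∀
  third : ∀ s e U V U₀ V₀ → - + 4 * (- + 2 * s) + (- e) * (U + V) ≡
          - + 2 * (- + 4 * s + e * (U₀ + V₀)) + - (e * ((U - + 2 * U₀) + (V - + 2 * V₀)))
  third = solve-∀

data IntrinsicShift (w δ : ℤ) : Set where
  integral      : w ≡ 0ℤ [mod 6 ] → δ ≡ 0ℤ → IntrinsicShift w δ
  half-integral : w ≡ + 3 [mod 6 ] → δ ≡ + 3 ⊎ δ ≡ - + 3 → IntrinsicShift w δ

EdgeShift-side : ∀ {s e w δ} → s ≡ + 1 [mod 3 ] → e ≡ + 1 ⊎ e ≡ - + 1 → IntrinsicShift w δ →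
                 EdgeShift (+ 2 * s - e * w) (e * δ)
EdgeShift-side (m₀ , refl) (inj₁ refl) (integral (m , refl) refl) = on-line (m₀ - m , identity m₀ m) refl
  where
  identity : ∀ m₀ m → + 2 * (+ 3 * m₀ + + 1) - + 1 * (+ 6 * m + 0ℤ) ≡ + 6 * (m₀ - m) + + 2
  identity = solve-∀
EdgeShift-side (m₀ , refl) (inj₂ refl) (integral (m , refl) refl) = on-line (m₀ + m , identity m₀ m) refl
  where
  identity : ∀ m₀ m → + 2 * (+ 3 * m₀ + + 1) - - + 1 * (+ 6 * m + 0ℤ) ≡ + 6 * (m₀ + m) + + 2
  identity = solve-∀
EdgeShift-side (m₀ , refl) (inj₁ refl) (half-integral (m , refl) δ≡) = off-line (m₀ - m - + 1 , identity m₀ m) (keep δ≡)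
  where
  identity : ∀ m₀ m → + 2 * (+ 3 * m₀ + + 1) - + 1 * (+ 6 * m + + 3) ≡ + 6 * (m₀ - m - + 1) + + 5
  identity = solve-∀
  keep : ∀ {δ} → δ ≡ + 3 ⊎ δ ≡ - + 3 → + 1 * δ ≡ + 3 ⊎ + 1 * δ ≡ - + 3
  keep (inj₁ refl) = inj₁ refl
  keep (inj₂ refl) = inj₂ refl
EdgeShift-side (m₀ , refl) (inj₂ refl) (half-integral (m , refl) δ≡) = off-line (m₀ + m , identity m₀ m) (negate δ≡)
  where
  identity : ∀ m₀ m → + 2 * (+ 3 * m₀ + + 1) - - + 1 * (+ 6 * m + + 3) ≡ + 6 * (m₀ + m) + + 5
  identity = solve-∀
  negate : ∀ {δ} → δ ≡ + 3 ⊎ δ ≡ - + 3 → - + 1 * δ ≡ + 3 ⊎ - + 1 * δ ≡ - + 3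
  negate (inj₁ refl) = inj₂ refl
  negate (inj₂ refl) = inj₁ refl

-- The third coordinate -4s + e w is the side coordinate 2s′ - e′w of s′ = -2s, e′ = -e.
EdgeShift-third : ∀ {s e w δ} → s ≡ + 1 [mod 3 ] → e ≡ + 1 ⊎ e ≡ - + 1 → IntrinsicShift w δ →
                  EdgeShift (- + 4 * s + e * w) (- (e * δ))
EdgeShift-third {s} {e} {w} {δ} s≡ e≡ shift =
  subst₂ EdgeShift (third s e w) (neg e δ) (EdgeShift-side (-2*-≡1[mod3] s≡) (negate e≡) shift)
  where
  third : ∀ s e w → + 2 * (- + 2 * s) - (- e) * w ≡ - + 4 * s + e * w
  third = solve-∀
  neg : ∀ e δ → (- e) * δ ≡ - (e * δ)
  neg = solve-∀
  negate : ∀ {e} → e ≡ + 1 ⊎ e ≡ - + 1 → - e ≡ + 1 ⊎ - e ≡ - + 1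
  negate (inj₁ refl) = inj₂ refl
  negate (inj₂ refl) = inj₁ refl

EdgeShifts-levelPoint : ∀ j {U V u v} → IntrinsicShift U u → IntrinsicShift V v → IntrinsicShift (U + V) (u + v) →
                        EdgeShifts (levelPoint j U V) (displacement (negOne^ j) u v)
EdgeShifts-levelPoint j {U} {V} {u} {v} sU sV sUV =
  EdgeShift-side s≡ e≡ sU , EdgeShift-side s≡ e≡ sV , EdgeShift-third s≡ e≡ sUV ,
  levelPoint-InPlane j U V , balanced (negOne^ j) u v
  where
  s≡ : negTwo^ j ≡ + 1 [mod 3 ]
  s≡ = negTwo^≡1[mod3] j
  e≡ : negOne^ j ≡ + 1 ⊎ negOne^ j ≡ - + 1
  e≡ = negOne^≡±1 j
  balanced : ∀ e u v → e * u + e * v + - (e * (u + v)) ≡ 0ℤ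
  balanced = solve-∀

Centre-upCentre : ∀ j a b → Centre (levelOrient j) (upCentre j a b)
Centre-upCentre j a b with level-parity j | negTwo^≡1[mod3] j | levelPoint-InPlane j (+ 6 * + a + + 2) (+ 6 * + b + + 2)
... | inj₁ (e≡ , o≡) | m₀ , t≡ | s rewrite e≡ | o≡ | t≡ =
  (m₀ - + a , side m₀ (+ a)) , (m₀ - + b , side m₀ (+ b)) , (+ a + + b - + 2 * m₀ , third m₀ (+ a) (+ b)) , s
  where
  side : ∀ m₀ a → + 2 * (+ 3 * m₀ + + 1) - + 1 * (+ 6 * a + + 2) ≡ + 6 * (m₀ - a) + 0ℤ
  side = solve-∀
  third : ∀ m₀ a b → - + 4 * (+ 3 * m₀ + + 1) + + 1 * ((+ 6 * a + + 2) + (+ 6 * b + + 2)) ≡ + 6 * (a + b - + 2 * m₀) + 0ℤ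
  third = solve-∀
... | inj₂ (e≡ , o≡) | m₀ , t≡ | s rewrite e≡ | o≡ | t≡ =
  (m₀ + + a , side m₀ (+ a)) , (m₀ + + b , side m₀ (+ b)) , (- + 2 * m₀ - + a - + b - + 2 , third m₀ (+ a) (+ b)) , s
  where
  side : ∀ m₀ a → + 2 * (+ 3 * m₀ + + 1) - - + 1 * (+ 6 * a + + 2) ≡ + 6 * (m₀ + a) + + 4
  side = solve-∀
  third : ∀ m₀ a b → - + 4 * (+ 3 * m₀ + + 1) + - + 1 * ((+ 6 * a + + 2) + (+ 6 * b + + 2)) ≡
                     + 6 * (- + 2 * m₀ - a - b - + 2) + + 4
  third = solve-∀

Centre-downCentre : ∀ j a b → Centre (flipO (levelOrient j)) (downCentre j a b)
Centre-downCentre j a b with level-parity j | negTwo^≡1[mod3] j | levelPoint-InPlane j (+ 6 * + a + + 4) (+ 6 * + b + + 4)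
... | inj₁ (e≡ , o≡) | m₀ , t≡ | s rewrite e≡ | o≡ | t≡ =
  (m₀ - + a - + 1 , side m₀ (+ a)) , (m₀ - + b - + 1 , side m₀ (+ b)) , (+ a + + b - + 2 * m₀ , third m₀ (+ a) (+ b)) , s
  where
  side : ∀ m₀ a → + 2 * (+ 3 * m₀ + + 1) - + 1 * (+ 6 * a + + 4) ≡ + 6 * (m₀ - a - + 1) + + 4
  side = solve-∀
  third : ∀ m₀ a b → - + 4 * (+ 3 * m₀ + + 1) + + 1 * ((+ 6 * a + + 4) + (+ 6 * b + + 4)) ≡ + 6 * (a + b - + 2 * m₀) + + 4
  third = solve-∀
... | inj₂ (e≡ , o≡) | m₀ , t≡ | s rewrite e≡ | o≡ | t≡ =
  (m₀ + + a + + 1 , side m₀ (+ a)) , (m₀ + + b + + 1 , side m₀ (+ b)) ,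
  (- + 2 * m₀ - + a - + b - + 2 , third m₀ (+ a) (+ b)) , s
  where
  side : ∀ m₀ a → + 2 * (+ 3 * m₀ + + 1) - - + 1 * (+ 6 * a + + 4) ≡ + 6 * (m₀ + a + + 1) + 0ℤ
  side = solve-∀
  third : ∀ m₀ a b → - + 4 * (+ 3 * m₀ + + 1) + - + 1 * ((+ 6 * a + + 4) + (+ 6 * b + + 4)) ≡
                     + 6 * (- + 2 * m₀ - a - b - + 2) + 0ℤ
  third = solve-∀

private
  0<unit²* : ∀ {e X} → e ≡ + 1 ⊎ e ≡ - + 1 → 0ℤ < X → 0ℤ < (e * e) * X
  0<unit²* (inj₁ refl) X>0 = subst (0ℤ <_) (sym (ℤₚ.*-identityˡ _)) X>0
  0<unit²* (inj₂ refl) X>0 = subst (0ℤ <_) (sym (ℤₚ.*-identityˡ _)) X>0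

  0<2* : ∀ {X} → 0ℤ < X → 0ℤ < + 2 * X
  0<2* = pos*pos {+ 2} (+<+ (s≤s z≤n))

Inside-triPoint : ∀ e N U V → e ≡ + 1 ⊎ e ≡ - + 1 → 0ℤ < N → 0ℤ < U → 0ℤ < V → U + V < + 6 * N →
                  Inside (e * N) (triPoint (e * N) e U V)
Inside-triPoint e N U V e≡ N>0 U>0 V>0 U+V<6N =
  subst (0ℤ <_) (sym (side e N U)) (0<unit²* e≡ (pos*pos U>0 N>0)) ,
  subst (0ℤ <_) (sym (side e N V)) (0<unit²* e≡ (pos*pos V>0 N>0)) ,
  subst (0ℤ <_) (sym (third e N U V)) (0<unit²* e≡ (pos*pos (<⇒0<- U+V<6N) N>0))
  where
  side : ∀ e N U → (+ 2 * (e * N) - (+ 2 * (e * N) - e * U)) * (e * N) ≡ (e * e) * (U * N)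
  side = solve-∀
  third : ∀ e N U V → (+ 2 * (e * N) - (- + 4 * (e * N) + e * (U + V))) * (e * N) ≡ (e * e) * ((+ 6 * N - (U + V)) * N)
  third = solve-∀

Inside-triPoint-double : ∀ e N U V → e ≡ + 1 ⊎ e ≡ - + 1 → 0ℤ < N → U < + 6 * N → V < + 6 * N → 0ℤ < U + V →
                         Inside (- + 2 * (e * N)) (triPoint (e * N) e U V)
Inside-triPoint-double e N U V e≡ N>0 U<6N V<6N U+V>0 =
  subst (0ℤ <_) (sym (side e N U)) (0<2* (0<unit²* e≡ (pos*pos (<⇒0<- U<6N) N>0))) ,
  subst (0ℤ <_) (sym (side e N V)) (0<2* (0<unit²* e≡ (pos*pos (<⇒0<- V<6N) N>0))) ,
  subst (0ℤ <_) (sym (third e N U V)) (0<2* (0<unit²* e≡ (pos*pos U+V>0 N>0)))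
  where
  side : ∀ e N U → (+ 2 * (- + 2 * (e * N)) - (+ 2 * (e * N) - e * U)) * (- + 2 * (e * N)) ≡ + 2 * ((e * e) * ((+ 6 * N - U) * N))
  side = solve-∀
  third : ∀ e N U V → (+ 2 * (- + 2 * (e * N)) - (- + 4 * (e * N) + e * (U + V))) * (- + 2 * (e * N)) ≡
                      + 2 * ((e * e) * ((U + V) * N))
  third = solve-∀

2^>0 : ∀ j → 0ℤ < + (2 ^ j)
2^>0 j = +<+ (ℕₚ.m^n>0 2 j)

Inside-levelPoint : ∀ j U V → 0ℤ < U → 0ℤ < V → U + V < + 6 * + (2 ^ j) → Inside (negTwo^ j) (levelPoint j U V)
Inside-levelPoint j U V U>0 V>0 U+V< =
  subst (λ s → Inside s (triPoint s (negOne^ j) U V)) (sym (negTwo^≡negOne^*2^ j))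
        (Inside-triPoint (negOne^ j) (+ (2 ^ j)) U V (negOne^≡±1 j) (2^>0 j) U>0 V>0 U+V<)

Inside-levelPoint-suc : ∀ j U V → U < + 6 * + (2 ^ j) → V < + 6 * + (2 ^ j) → 0ℤ < U + V →
                        Inside (negTwo^ (suc j)) (levelPoint j U V)
Inside-levelPoint-suc j U V U< V< U+V>0 =
  subst (λ s → Inside (- + 2 * s) (triPoint s (negOne^ j) U V)) (sym (negTwo^≡negOne^*2^ j))
        (Inside-triPoint-double (negOne^ j) (+ (2 ^ j)) U V (negOne^≡±1 j) (2^>0 j) U< V< U+V>0)

opp-involutive : ∀ c → opp (opp c) ≡ c
opp-involutive red = refl
opp-involutive blue = refl

midsegmentColor-false : ∀ o → midsegmentColor false o ≡ opp (midColor o)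
midsegmentColor-false positive = refl
midsegmentColor-false negative = refl

-- The colouring of (-2)^j T₀, in its intrinsic coordinates, left by j foldings up; F₊ reverses the
-- colour of every halved edge, whereas a folding keeps it, hence the opp.
foldedPattern : ℕ → Coloring
foldedPattern zero = σ
foldedPattern (suc j) t a b = opp (Fplus (levelOrient j) (foldedPattern j) t a b)

module _ (j a b : ℕ) where
  private
    P = foldedPattern j
    o = levelOrient j

  A-halved : even b ≡ true → foldedPattern (suc j) A a b ≡ P A (half a) (half b)
  A-halved eb rewrite eb = opp-involutive _

  A-up : even b ≡ false → even a ≡ true → foldedPattern (suc j) A a b ≡ midsegmentColor false o
  A-up eb ea rewrite eb | ea = sym (midsegmentColor-false o)

  A-down : even b ≡ false → even a ≡ false → foldedPattern (suc j) A a b ≡ midsegmentColor false (flipO o)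
  A-down eb ea rewrite eb | ea = sym (midsegmentColor-false (flipO o))

  B-halved : even a ≡ true → foldedPattern (suc j) B a b ≡ P B (half a) (half b)
  B-halved ea rewrite ea = opp-involutive _

  B-up : even a ≡ false → even b ≡ true → foldedPattern (suc j) B a b ≡ midsegmentColor false o
  B-up ea eb rewrite ea | eb = sym (midsegmentColor-false o)

  B-down : even a ≡ false → even b ≡ false → foldedPattern (suc j) B a b ≡ midsegmentColor false (flipO o)
  B-down ea eb rewrite ea | eb = sym (midsegmentColor-false (flipO o))

  C-halved : even (a ℕ.+ b) ≡ false → foldedPattern (suc j) C a b ≡ P C (half a) (half b)
  C-halved eab rewrite eab = opp-involutive _

  C-up : even (a ℕ.+ b) ≡ true → even a ≡ true → foldedPattern (suc j) C a b ≡ midsegmentColor false o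
  C-up eab ea rewrite eab | ea = sym (midsegmentColor-false o)

  C-down : even (a ℕ.+ b) ≡ true → even a ≡ false → foldedPattern (suc j) C a b ≡ midsegmentColor false (flipO o)
  C-down eab ea rewrite eab | ea = sym (midsegmentColor-false (flipO o))

data Parity (a : ℕ) : Set where
  even-half : even a ≡ true  → a ≡ 0 ℕ.+ (half a ℕ.+ half a) → Parity a
  odd-half  : even a ≡ false → a ≡ 1 ℕ.+ (half a ℕ.+ half a) → Parity a

parity : ∀ a → Parity a
parity zero = even-half refl refl
parity (suc zero) = odd-half refl refl
parity (suc (suc a)) with parity a
... | even-half ea a≡ = even-half ea (cong suc (trans (cong suc a≡) (sym (ℕₚ.+-suc (half a) (half a)))))
... | odd-half ea a≡ = odd-half ea (cong suc (trans (cong suc a≡) (cong suc (sym (ℕₚ.+-suc (half a) (half a))))))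

even-+-double : ∀ k u → even (k ℕ.+ (u ℕ.+ u)) ≡ even k
even-+-double k zero = cong even (ℕₚ.+-identityʳ k)
even-+-double k (suc u) = trans (cong even (double-suc k u)) (even-+-double k u)
  where
  double-suc : ∀ k u → k ℕ.+ (suc u ℕ.+ suc u) ≡ suc (suc (k ℕ.+ (u ℕ.+ u)))
  double-suc = ℕ-Solver.solve-∀

sum-halves : ∀ {a b} a₁ b₁ i i′ → a ≡ i ℕ.+ (a₁ ℕ.+ a₁) → b ≡ i′ ℕ.+ (b₁ ℕ.+ b₁) →
             a ℕ.+ b ≡ (i ℕ.+ i′) ℕ.+ ((a₁ ℕ.+ b₁) ℕ.+ (a₁ ℕ.+ b₁))
sum-halves a₁ b₁ i i′ refl refl = regroup a₁ b₁ i i′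
  where
  regroup : ∀ a₁ b₁ i i′ → i ℕ.+ (a₁ ℕ.+ a₁) ℕ.+ (i′ ℕ.+ (b₁ ℕ.+ b₁)) ≡ (i ℕ.+ i′) ℕ.+ ((a₁ ℕ.+ b₁) ℕ.+ (a₁ ℕ.+ b₁))
  regroup = ℕ-Solver.solve-∀

half-< : ∀ k u M → k ℕ.+ (u ℕ.+ u) ℕ.< 2 ℕ.* M → u ℕ.< M
half-< k u M bound =
  ℕₚ.*-cancelˡ-< 2 u M (ℕₚ.≤-<-trans (subst (ℕ._≤ k ℕ.+ (u ℕ.+ u)) (double u) (ℕₚ.m≤n+m (u ℕ.+ u) k)) bound)
  where
  double : ∀ u → u ℕ.+ u ≡ 2 ℕ.* u
  double = ℕ-Solver.solve-∀

suc-half-< : ∀ u M → 2 ℕ.+ (u ℕ.+ u) ℕ.< 2 ℕ.* M → suc u ℕ.< M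
suc-half-< u M bound = half-< 0 (suc u) M (subst (ℕ._< 2 ℕ.* M) (cong suc (sym (ℕₚ.+-suc u u))) bound)

positive-half : ∀ {b} b₁ → 0 ℕ.< b → b ≡ 0 ℕ.+ (b₁ ℕ.+ b₁) → 0 ℕ.< b₁
positive-half zero b>0 refl = b>0
positive-half (suc b₁) _ _ = s≤s z≤n

coordinate-shift : ∀ {a} a₁ i c c₀ → a ≡ i ℕ.+ (a₁ ℕ.+ a₁) →
                   (+ 6 * + a + c) - + 2 * (+ 6 * + a₁ + c₀) ≡ + 6 * + i + c - + 2 * c₀
coordinate-shift a₁ i c c₀ refl = identity (+ a₁) (+ i) c c₀
  where
  identity : ∀ a₁ i c c₀ → (+ 6 * (i + (a₁ + a₁)) + c) - + 2 * (+ 6 * a₁ + c₀) ≡ + 6 * i + c - + 2 * c₀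
  identity = solve-∀

displacement-midsegment : ∀ j u v i → displacement (+ 1) u v ≡ midsegment positive i →
  displacement (- + 1) u v ≡ midsegment negative i → displacement (negOne^ j) u v ≡ midsegment (levelOrient j) i
displacement-midsegment j u v i d₊ d₋ with level-parity j
... | inj₁ (e≡ , o≡) rewrite e≡ | o≡ = d₊
... | inj₂ (e≡ , o≡) rewrite e≡ | o≡ = d₋

displacement-midsegment-flip : ∀ j u v i → displacement (+ 1) u v ≡ midsegment negative i →
  displacement (- + 1) u v ≡ midsegment positive i → displacement (negOne^ j) u v ≡ midsegment (flipO (levelOrient j)) i
displacement-midsegment-flip j u v i d₊ d₋ with level-parity j
... | inj₁ (e≡ , o≡) rewrite e≡ | o≡ = d₊
... | inj₂ (e≡ , o≡) rewrite e≡ | o≡ = d₋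

Inside-upCentre : ∀ j a b → a ℕ.+ b ℕ.< 2 ^ j → Inside (negTwo^ j) (upCentre j a b)
Inside-upCentre j a b bound = Inside-levelPoint j _ _ (affine-pos 6 1 a) (affine-pos 6 1 b)
  (subst (_< + 6 * + (2 ^ j)) (sym (identity (+ a) (+ b))) (6*+<6* (a ℕ.+ b) 4 (2 ^ j) bound (<-lit 4 6)))
  where
  identity : ∀ a b → (+ 6 * a + + 2) + (+ 6 * b + + 2) ≡ + 6 * (a + b) + + 4
  identity = solve-∀

Inside-downCentre : ∀ j a b → suc (a ℕ.+ b) ℕ.< 2 ^ j → Inside (negTwo^ j) (downCentre j a b)
Inside-downCentre j a b bound = Inside-levelPoint j _ _ (affine-pos 6 3 a) (affine-pos 6 3 b)
  (subst (_< + 6 * + (2 ^ j)) (sym (identity (+ a) (+ b))) (6*+<6* (suc (a ℕ.+ b)) 2 (2 ^ j) bound (<-lit 2 6)))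
  where
  identity : ∀ a b → (+ 6 * a + + 4) + (+ 6 * b + + 4) ≡ + 6 * (+ 1 + (a + b)) + + 2
  identity = solve-∀

halved-edge : ∀ j {U V U₀ V₀ u v c} → U - + 2 * U₀ ≡ u → V - + 2 * V₀ ≡ v →
  IntrinsicShift U₀ u → IntrinsicShift V₀ v → IntrinsicShift (U₀ + V₀) (u + v) →
  foldColor allUp j false (levelPoint j U₀ V₀) ≡ just c → foldColor allUp (suc j) false (levelPoint (suc j) U V) ≡ just c
halved-edge j {U} {V} {U₀} {V₀} {c = c} u≡ v≡ sU sV sUV colored =
  subst (λ P → foldColor allUp (suc j) false P ≡ just c) (sym (levelPoint-suc j U V U₀ V₀ u≡ v≡))
        (foldColor-rescale j false _ _ (EdgeShifts-levelPoint j sU sV sUV) colored)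

midsegment-edge : ∀ j o i {U V U₀ V₀ u v} → U - + 2 * U₀ ≡ u → V - + 2 * V₀ ≡ v →
  displacement (negOne^ j) u v ≡ midsegment o i → Centre o (levelPoint j U₀ V₀) → Inside (negTwo^ j) (levelPoint j U₀ V₀) →
  foldColor allUp (suc j) false (levelPoint (suc j) U V) ≡ just (midsegmentColor false o)
midsegment-edge j o i {U} {V} {U₀} {V₀} u≡ v≡ d≡ centre inside =
  trans (cong (foldColor allUp (suc j) false)
              (trans (levelPoint-suc j U V U₀ V₀ u≡ v≡) (cong (rescale (levelPoint j U₀ V₀)) d≡)))
        (foldColor-centre j false o (levelPoint j U₀ V₀) i centre inside)

halves-< : ∀ {a b} M a₁ b₁ i i′ → a ≡ i ℕ.+ (a₁ ℕ.+ a₁) → b ≡ i′ ℕ.+ (b₁ ℕ.+ b₁) →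
           a ℕ.+ b ℕ.< 2 ℕ.* M → a₁ ℕ.+ b₁ ℕ.< M
halves-< M a₁ b₁ i i′ ea eb bound =
  half-< (i ℕ.+ i′) (a₁ ℕ.+ b₁) M (subst (ℕ._< 2 ℕ.* M) (sum-halves a₁ b₁ i i′ ea eb) bound)

odd-halves-< : ∀ {a b} M a₁ b₁ → a ≡ 1 ℕ.+ (a₁ ℕ.+ a₁) → b ≡ 1 ℕ.+ (b₁ ℕ.+ b₁) →
               a ℕ.+ b ℕ.< 2 ℕ.* M → suc (a₁ ℕ.+ b₁) ℕ.< M
odd-halves-< M a₁ b₁ ea eb bound = suc-half-< (a₁ ℕ.+ b₁) M (subst (ℕ._< 2 ℕ.* M) (sum-halves a₁ b₁ 1 1 ea eb) bound)

Inner : ℕ → EType → ℕ → ℕ → Set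
Inner M A a b = 0 ℕ.< b
Inner M B a b = 0 ℕ.< a
Inner M C a b = suc (a ℕ.+ b) ℕ.< M

EdgeColors : ℕ → Set
EdgeColors j = ∀ t a b → a ℕ.+ b ℕ.< 2 ^ j → Inner (2 ^ j) t a b →
               foldColor allUp j false (edgeMidpoint j t a b) ≡ just (foldedPattern j t a b)

sum₃₀ : ∀ a b → (+ 6 * a + + 3) + (+ 6 * b + 0ℤ) ≡ + 6 * (a + b) + + 3
sum₃₀ = solve-∀

sum₀₃ : ∀ a b → (+ 6 * a + 0ℤ) + (+ 6 * b + + 3) ≡ + 6 * (a + b) + + 3
sum₀₃ = solve-∀

sum₃₃ : ∀ a b → (+ 6 * a + + 3) + (+ 6 * b + + 3) ≡ + 6 * (+ 1 + (a + b)) + 0ℤ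
sum₃₃ = solve-∀

EdgeColors-A : ∀ j → EdgeColors j → ∀ a b → a ℕ.+ b ℕ.< 2 ^ suc j → 0 ℕ.< b →
               foldColor allUp (suc j) false (edgeMidpoint (suc j) A a b) ≡ just (foldedPattern (suc j) A a b)
EdgeColors-A j ih a b bound b>0 with parity a | parity b
... | even-half _ ea | even-half pb eb =
  trans (halved-edge j (coordinate-shift a₁ 0 (+ 3) (+ 3) ea) (coordinate-shift b₁ 0 0ℤ 0ℤ eb)
           (half-integral (+ a₁ , refl) (inj₂ refl)) (integral (+ b₁ , refl) refl) (half-integral (+ a₁ + + b₁ , sum₃₀ (+ a₁) (+ b₁)) (inj₂ refl))
           (ih A a₁ b₁ (halves-< (2 ^ j) a₁ b₁ 0 0 ea eb bound) (positive-half b₁ b>0 eb)))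
        (cong just (sym (A-halved j a b pb)))
  where a₁ = half a ; b₁ = half b
... | odd-half _ ea | even-half pb eb =
  trans (halved-edge j (coordinate-shift a₁ 1 (+ 3) (+ 3) ea) (coordinate-shift b₁ 0 0ℤ 0ℤ eb)
           (half-integral (+ a₁ , refl) (inj₁ refl)) (integral (+ b₁ , refl) refl) (half-integral (+ a₁ + + b₁ , sum₃₀ (+ a₁) (+ b₁)) (inj₁ refl))
           (ih A a₁ b₁ (halves-< (2 ^ j) a₁ b₁ 1 0 ea eb bound) (positive-half b₁ b>0 eb)))
        (cong just (sym (A-halved j a b pb)))
  where a₁ = half a ; b₁ = half b
... | even-half pa ea | odd-half pb eb =
  trans (midsegment-edge j (levelOrient j) side₂ (coordinate-shift a₁ 0 (+ 3) (+ 2) ea) (coordinate-shift b₁ 1 0ℤ (+ 2) eb)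
           (displacement-midsegment j _ _ side₂ refl refl) (Centre-upCentre j a₁ b₁)
           (Inside-upCentre j a₁ b₁ (halves-< (2 ^ j) a₁ b₁ 0 1 ea eb bound)))
        (cong just (sym (A-up j a b pb pa)))
  where a₁ = half a ; b₁ = half b
... | odd-half pa ea | odd-half pb eb =
  trans (midsegment-edge j (flipO (levelOrient j)) side₂ (coordinate-shift a₁ 1 (+ 3) (+ 4) ea) (coordinate-shift b₁ 1 0ℤ (+ 4) eb)
           (displacement-midsegment-flip j _ _ side₂ refl refl) (Centre-downCentre j a₁ b₁)
           (Inside-downCentre j a₁ b₁ (odd-halves-< (2 ^ j) a₁ b₁ ea eb bound)))
        (cong just (sym (A-down j a b pb pa)))
  where a₁ = half a ; b₁ = half b

EdgeColors-B : ∀ j → EdgeColors j → ∀ a b → a ℕ.+ b ℕ.< 2 ^ suc j → 0 ℕ.< a →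
               foldColor allUp (suc j) false (edgeMidpoint (suc j) B a b) ≡ just (foldedPattern (suc j) B a b)
EdgeColors-B j ih a b bound a>0 with parity a | parity b
... | even-half pa ea | even-half _ eb =
  trans (halved-edge j (coordinate-shift a₁ 0 0ℤ 0ℤ ea) (coordinate-shift b₁ 0 (+ 3) (+ 3) eb)
           (integral (+ a₁ , refl) refl) (half-integral (+ b₁ , refl) (inj₂ refl)) (half-integral (+ a₁ + + b₁ , sum₀₃ (+ a₁) (+ b₁)) (inj₂ refl))
           (ih B a₁ b₁ (halves-< (2 ^ j) a₁ b₁ 0 0 ea eb bound) (positive-half a₁ a>0 ea)))
        (cong just (sym (B-halved j a b pa)))
  where a₁ = half a ; b₁ = half b
... | even-half pa ea | odd-half _ eb =
  trans (halved-edge j (coordinate-shift a₁ 0 0ℤ 0ℤ ea) (coordinate-shift b₁ 1 (+ 3) (+ 3) eb)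
           (integral (+ a₁ , refl) refl) (half-integral (+ b₁ , refl) (inj₁ refl)) (half-integral (+ a₁ + + b₁ , sum₀₃ (+ a₁) (+ b₁)) (inj₁ refl))
           (ih B a₁ b₁ (halves-< (2 ^ j) a₁ b₁ 0 1 ea eb bound) (positive-half a₁ a>0 ea)))
        (cong just (sym (B-halved j a b pa)))
  where a₁ = half a ; b₁ = half b
... | odd-half pa ea | even-half pb eb =
  trans (midsegment-edge j (levelOrient j) side₁ (coordinate-shift a₁ 1 0ℤ (+ 2) ea) (coordinate-shift b₁ 0 (+ 3) (+ 2) eb)
           (displacement-midsegment j _ _ side₁ refl refl) (Centre-upCentre j a₁ b₁)
           (Inside-upCentre j a₁ b₁ (halves-< (2 ^ j) a₁ b₁ 1 0 ea eb bound)))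
        (cong just (sym (B-up j a b pa pb)))
  where a₁ = half a ; b₁ = half b
... | odd-half pa ea | odd-half pb eb =
  trans (midsegment-edge j (flipO (levelOrient j)) side₁ (coordinate-shift a₁ 1 0ℤ (+ 4) ea) (coordinate-shift b₁ 1 (+ 3) (+ 4) eb)
           (displacement-midsegment-flip j _ _ side₁ refl refl) (Centre-downCentre j a₁ b₁)
           (Inside-downCentre j a₁ b₁ (odd-halves-< (2 ^ j) a₁ b₁ ea eb bound)))
        (cong just (sym (B-down j a b pa pb)))
  where a₁ = half a ; b₁ = half b

even-sum : ∀ {a b} a₁ b₁ i i′ → a ≡ i ℕ.+ (a₁ ℕ.+ a₁) → b ≡ i′ ℕ.+ (b₁ ℕ.+ b₁) →
           even (a ℕ.+ b) ≡ even (i ℕ.+ i′)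
even-sum a₁ b₁ i i′ ea eb = trans (cong even (sum-halves a₁ b₁ i i′ ea eb)) (even-+-double (i ℕ.+ i′) (a₁ ℕ.+ b₁))

mixed-halves-< : ∀ {a b} M a₁ b₁ i i′ → a ≡ i ℕ.+ (a₁ ℕ.+ a₁) → b ≡ i′ ℕ.+ (b₁ ℕ.+ b₁) → i ℕ.+ i′ ≡ 1 →
                 suc (a ℕ.+ b) ℕ.< 2 ℕ.* M → suc (a₁ ℕ.+ b₁) ℕ.< M
mixed-halves-< M a₁ b₁ i i′ ea eb i+i′≡1 bound =
  suc-half-< (a₁ ℕ.+ b₁) M
    (subst (λ w → suc w ℕ.< 2 ℕ.* M)
           (trans (sum-halves a₁ b₁ i i′ ea eb) (cong (ℕ._+ ((a₁ ℕ.+ b₁) ℕ.+ (a₁ ℕ.+ b₁))) i+i′≡1)) bound)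

EdgeColors-C : ∀ j → EdgeColors j → ∀ a b → a ℕ.+ b ℕ.< 2 ^ suc j → suc (a ℕ.+ b) ℕ.< 2 ^ suc j →
               foldColor allUp (suc j) false (edgeMidpoint (suc j) C a b) ≡ just (foldedPattern (suc j) C a b)
EdgeColors-C j ih a b bound inner with parity a | parity b
... | even-half pa ea | even-half _ eb =
  trans (midsegment-edge j (levelOrient j) side₃ (coordinate-shift a₁ 0 (+ 3) (+ 2) ea) (coordinate-shift b₁ 0 (+ 3) (+ 2) eb)
           (displacement-midsegment j _ _ side₃ refl refl) (Centre-upCentre j a₁ b₁)
           (Inside-upCentre j a₁ b₁ (halves-< (2 ^ j) a₁ b₁ 0 0 ea eb bound)))
        (cong just (sym (C-up j a b (even-sum a₁ b₁ 0 0 ea eb) pa)))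
  where a₁ = half a ; b₁ = half b
... | odd-half pa ea | odd-half _ eb =
  trans (midsegment-edge j (flipO (levelOrient j)) side₃ (coordinate-shift a₁ 1 (+ 3) (+ 4) ea) (coordinate-shift b₁ 1 (+ 3) (+ 4) eb)
           (displacement-midsegment-flip j _ _ side₃ refl refl) (Centre-downCentre j a₁ b₁)
           (Inside-downCentre j a₁ b₁ (odd-halves-< (2 ^ j) a₁ b₁ ea eb bound)))
        (cong just (sym (C-down j a b (even-sum a₁ b₁ 1 1 ea eb) pa)))
  where a₁ = half a ; b₁ = half b
... | odd-half _ ea | even-half _ eb =
  trans (halved-edge j (coordinate-shift a₁ 1 (+ 3) (+ 3) ea) (coordinate-shift b₁ 0 (+ 3) (+ 3) eb)
           (half-integral (+ a₁ , refl) (inj₁ refl)) (half-integral (+ b₁ , refl) (inj₂ refl))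
           (integral (+ 1 + (+ a₁ + + b₁) , sum₃₃ (+ a₁) (+ b₁)) refl)
           (ih C a₁ b₁ (ℕₚ.<-trans (ℕₚ.n<1+n _) inner′) inner′))
        (cong just (sym (C-halved j a b (even-sum a₁ b₁ 1 0 ea eb))))
  where
  a₁ = half a ; b₁ = half b
  inner′ : suc (a₁ ℕ.+ b₁) ℕ.< 2 ^ j
  inner′ = mixed-halves-< (2 ^ j) a₁ b₁ 1 0 ea eb refl inner
... | even-half _ ea | odd-half _ eb =
  trans (halved-edge j (coordinate-shift a₁ 0 (+ 3) (+ 3) ea) (coordinate-shift b₁ 1 (+ 3) (+ 3) eb)
           (half-integral (+ a₁ , refl) (inj₂ refl)) (half-integral (+ b₁ , refl) (inj₁ refl))
           (integral (+ 1 + (+ a₁ + + b₁) , sum₃₃ (+ a₁) (+ b₁)) refl)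
           (ih C a₁ b₁ (ℕₚ.<-trans (ℕₚ.n<1+n _) inner′) inner′))
        (cong just (sym (C-halved j a b (even-sum a₁ b₁ 0 1 ea eb))))
  where
  a₁ = half a ; b₁ = half b
  inner′ : suc (a₁ ℕ.+ b₁) ℕ.< 2 ^ j
  inner′ = mixed-halves-< (2 ^ j) a₁ b₁ 0 1 ea eb refl inner

edgeColors : ∀ j → EdgeColors j
edgeColors zero A a b bound b>0 with ℕₚ.≤-trans b>0 (ℕₚ.≤-trans (ℕₚ.m≤n+m b a) (ℕₚ.≤-pred bound))
... | ()
edgeColors zero B a b bound a>0 with ℕₚ.≤-trans a>0 (ℕₚ.≤-trans (ℕₚ.m≤m+n a b) (ℕₚ.≤-pred bound))
... | ()
edgeColors zero C a b _ (s≤s ())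
edgeColors (suc j) A = EdgeColors-A j (edgeColors j)
edgeColors (suc j) B = EdgeColors-B j (edgeColors j)
edgeColors (suc j) C = EdgeColors-C j (edgeColors j)

A-boundary : ∀ j a → foldedPattern j A a 0 ≡ red
A-boundary zero a = refl
A-boundary (suc j) a = trans (A-halved j a 0 refl) (A-boundary j (half a))

B-boundary : ∀ j b → foldedPattern j B 0 b ≡ red
B-boundary zero b = refl
B-boundary (suc j) b = trans (B-halved j 0 b refl) (B-boundary j (half b))

even-2* : ∀ M → even (2 ℕ.* M) ≡ true
even-2* M = trans (cong even (double M)) (even-+-double 0 M)
  where
  double : ∀ M → 2 ℕ.* M ≡ 0 ℕ.+ (M ℕ.+ M)
  double = ℕ-Solver.solve-∀

side-parity : ∀ {a b} M a₁ b₁ i i′ → a ≡ i ℕ.+ (a₁ ℕ.+ a₁) → b ≡ i′ ℕ.+ (b₁ ℕ.+ b₁) → suc (a ℕ.+ b) ≡ 2 ℕ.* M →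
              even (suc (i ℕ.+ i′)) ≡ true
side-parity M a₁ b₁ i i′ ea eb on-side =
  trans (sym (even-+-double (suc (i ℕ.+ i′)) (a₁ ℕ.+ b₁)))
        (trans (cong (λ w → even (suc w)) (sym (sum-halves a₁ b₁ i i′ ea eb))) (trans (cong even on-side) (even-2* M)))

halve-side : ∀ {a b} M a₁ b₁ i i′ → a ≡ i ℕ.+ (a₁ ℕ.+ a₁) → b ≡ i′ ℕ.+ (b₁ ℕ.+ b₁) → i ℕ.+ i′ ≡ 1 →
             suc (a ℕ.+ b) ≡ 2 ℕ.* M → suc (a₁ ℕ.+ b₁) ≡ M
halve-side {a} {b} M a₁ b₁ i i′ ea eb i+i′≡1 on-side =
  ℕₚ.*-cancelˡ-≡ (suc (a₁ ℕ.+ b₁)) M 2 (trans (double-suc (a₁ ℕ.+ b₁)) (trans (cong suc (sym a+b≡)) on-side))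
  where
  a+b≡ : a ℕ.+ b ≡ 1 ℕ.+ ((a₁ ℕ.+ b₁) ℕ.+ (a₁ ℕ.+ b₁))
  a+b≡ = trans (sum-halves a₁ b₁ i i′ ea eb) (cong (ℕ._+ ((a₁ ℕ.+ b₁) ℕ.+ (a₁ ℕ.+ b₁))) i+i′≡1)
  double-suc : ∀ s → 2 ℕ.* suc s ≡ suc (1 ℕ.+ (s ℕ.+ s))
  double-suc = ℕ-Solver.solve-∀

-- On the third side a + b + 1 = 2^(j+1) is even, so a and b have opposite parities.
C-boundary : ∀ j a b → suc (a ℕ.+ b) ≡ 2 ^ j → foldedPattern j C a b ≡ red
C-boundary zero a b _ = refl
C-boundary (suc j) a b on-side with parity a | parity b
... | even-half _ ea | even-half _ eb with () ← side-parity (2 ^ j) (half a) (half b) 0 0 ea eb on-side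
... | odd-half _ ea | odd-half _ eb with () ← side-parity (2 ^ j) (half a) (half b) 1 1 ea eb on-side
... | odd-half _ ea | even-half _ eb =
  trans (C-halved j a b (even-sum (half a) (half b) 1 0 ea eb))
        (C-boundary j (half a) (half b) (halve-side (2 ^ j) (half a) (half b) 1 0 ea eb refl on-side))
... | even-half _ ea | odd-half _ eb =
  trans (C-halved j a b (even-sum (half a) (half b) 0 1 ea eb))
        (C-boundary j (half a) (half b) (halve-side (2 ^ j) (half a) (half b) 0 1 ea eb refl on-side))

module _ (j : ℕ) (fl : Bool) where
  private
    t = negTwo^ j

  foldColor-onCrease₁ : ∀ P → onCrease t (proj₁ P) ≡ true →
                        foldColor allUp (suc j) fl P ≡ just (creaseColor plus fl)
  foldColor-onCrease₁ (x , y , z) on rewrite on = refl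

  foldColor-onCrease₂ : ∀ P → onCrease t (proj₁ (proj₂ P)) ≡ true →
                        foldColor allUp (suc j) fl P ≡ just (creaseColor plus fl)
  foldColor-onCrease₂ (x , y , z) on rewrite on | Boolₚ.∨-zeroʳ (onCrease t x) = refl

  foldColor-onCrease₃ : ∀ P → onCrease t (proj₂ (proj₂ P)) ≡ true →
                        foldColor allUp (suc j) fl P ≡ just (creaseColor plus fl)
  foldColor-onCrease₃ (x , y , z) on rewrite on | Boolₚ.∨-zeroʳ (onCrease t y) | Boolₚ.∨-zeroʳ (onCrease t x) = refl

side-on-crease : ∀ s e → + 2 * s - e * (+ 6 * + 0 + 0ℤ) ≡ + 2 * s
side-on-crease = solve-∀

third-on-crease : ∀ j a b → suc (a ℕ.+ b) ≡ 2 ^ j →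
                  - + 4 * negTwo^ j + negOne^ j * ((+ 6 * + a + + 3) + (+ 6 * + b + + 3)) ≡ + 2 * negTwo^ j
third-on-crease j a b on-side = begin
  - + 4 * negTwo^ j + negOne^ j * ((+ 6 * + a + + 3) + (+ 6 * + b + + 3))
    ≡⟨ cong (λ s → - + 4 * s + negOne^ j * ((+ 6 * + a + + 3) + (+ 6 * + b + + 3))) (negTwo^≡negOne^*2^ j) ⟩
  - + 4 * (negOne^ j * + (2 ^ j)) + negOne^ j * ((+ 6 * + a + + 3) + (+ 6 * + b + + 3))
    ≡⟨ cong (λ M → - + 4 * (negOne^ j * + M) + negOne^ j * ((+ 6 * + a + + 3) + (+ 6 * + b + + 3))) (sym on-side) ⟩
  - + 4 * (negOne^ j * (+ 1 + (+ a + + b))) + negOne^ j * ((+ 6 * + a + + 3) + (+ 6 * + b + + 3))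
    ≡⟨ identity (negOne^ j) (+ a) (+ b) ⟩
  + 2 * (negOne^ j * (+ 1 + (+ a + + b)))
    ≡⟨ cong (λ M → + 2 * (negOne^ j * + M)) on-side ⟩
  + 2 * (negOne^ j * + (2 ^ j))
    ≡⟨ cong (+ 2 *_) (sym (negTwo^≡negOne^*2^ j)) ⟩
  + 2 * negTwo^ j ∎
  where
  open ≡-Reasoning
  identity : ∀ e a b → - + 4 * (e * (+ 1 + (a + b))) + e * ((+ 6 * a + + 3) + (+ 6 * b + + 3)) ≡ + 2 * (e * (+ 1 + (a + b)))
  identity = solve-∀

Inside-edgeMidpoint : ∀ j t a b → a ℕ.+ b ℕ.< 2 ^ j → Inner (2 ^ j) t a b → Inside (negTwo^ j) (edgeMidpoint j t a b)
Inside-edgeMidpoint j A a (suc b) bound _ = Inside-levelPoint j _ _ (affine-pos 6 2 a) (+<+ (s≤s z≤n))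
  (subst (_< _) (sym (sum₃₀ (+ a) (+ suc b))) (6*+<6* (a ℕ.+ suc b) 3 (2 ^ j) bound (<-lit 3 6)))
Inside-edgeMidpoint j B (suc a) b bound _ = Inside-levelPoint j _ _ (+<+ (s≤s z≤n)) (affine-pos 6 2 b)
  (subst (_< _) (sym (sum₀₃ (+ suc a) (+ b))) (6*+<6* (suc a ℕ.+ b) 3 (2 ^ j) bound (<-lit 3 6)))
Inside-edgeMidpoint j C a b _ inner = Inside-levelPoint j _ _ (affine-pos 6 2 a) (affine-pos 6 2 b)
  (subst (_< _) (sym (sum₃₃ (+ a) (+ b))) (6*+<6* (suc (a ℕ.+ b)) 0 (2 ^ j) inner (<-lit 0 6)))

Inside-edgeMidpoint-suc : ∀ j t a b → a ℕ.+ b ℕ.< 2 ^ j → Inside (negTwo^ (suc j)) (edgeMidpoint j t a b)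
Inside-edgeMidpoint-suc j A a b bound = Inside-levelPoint-suc j _ _ (6*+<6* a 3 _ a< (<-lit 3 6)) (6*+<6* b 0 _ b< (<-lit 0 6))
  (subst (0ℤ <_) (sym (sum₃₀ (+ a) (+ b))) (affine-pos 6 2 (a ℕ.+ b)))
  where
  a< : a ℕ.< 2 ^ j
  a< = ℕₚ.≤-<-trans (ℕₚ.m≤m+n a b) bound
  b< : b ℕ.< 2 ^ j
  b< = ℕₚ.≤-<-trans (ℕₚ.m≤n+m b a) bound
Inside-edgeMidpoint-suc j B a b bound = Inside-levelPoint-suc j _ _ (6*+<6* a 0 _ a< (<-lit 0 6)) (6*+<6* b 3 _ b< (<-lit 3 6))
  (subst (0ℤ <_) (sym (sum₀₃ (+ a) (+ b))) (affine-pos 6 2 (a ℕ.+ b)))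
  where
  a< : a ℕ.< 2 ^ j
  a< = ℕₚ.≤-<-trans (ℕₚ.m≤m+n a b) bound
  b< : b ℕ.< 2 ^ j
  b< = ℕₚ.≤-<-trans (ℕₚ.m≤n+m b a) bound
Inside-edgeMidpoint-suc j C a b bound = Inside-levelPoint-suc j _ _ (6*+<6* a 3 _ a< (<-lit 3 6)) (6*+<6* b 3 _ b< (<-lit 3 6))
  (subst (0ℤ <_) (sym (sum₃₃ (+ a) (+ b))) (+<+ (s≤s z≤n)))
  where
  a< : a ℕ.< 2 ^ j
  a< = ℕₚ.≤-<-trans (ℕₚ.m≤m+n a b) bound
  b< : b ℕ.< 2 ^ j
  b< = ℕₚ.≤-<-trans (ℕₚ.m≤n+m b a) bound

edgeColors-suc : ∀ j t a b → a ℕ.+ b ℕ.< 2 ^ j →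
                 foldColor allUp (suc j) false (edgeMidpoint j t a b) ≡ just (foldedPattern j t a b)
edgeColors-suc j A a zero _ =
  trans (foldColor-onCrease₂ j false (edgeMidpoint j A a 0) (⌊⌋-true (_ ℤₚ.≟ _) (side-on-crease (negTwo^ j) (negOne^ j))))
        (cong just (sym (A-boundary j a)))
edgeColors-suc j B zero b _ =
  trans (foldColor-onCrease₁ j false (edgeMidpoint j B 0 b) (⌊⌋-true (_ ℤₚ.≟ _) (side-on-crease (negTwo^ j) (negOne^ j))))
        (cong just (sym (B-boundary j b)))
edgeColors-suc j C a b bound with ℕₚ.m≤n⇒m<n∨m≡n bound
... | inj₁ inner = trans (foldColor-inside j false _ (Inside-edgeMidpoint j C a b bound inner)) (edgeColors j C a b bound inner)
... | inj₂ on-side =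
  trans (foldColor-onCrease₃ j false (edgeMidpoint j C a b) (⌊⌋-true (_ ℤₚ.≟ _) (third-on-crease j a b on-side)))
        (cong just (sym (C-boundary j a b on-side)))
edgeColors-suc j A a (suc b) bound =
  trans (foldColor-inside j false _ (Inside-edgeMidpoint j A a (suc b) bound (s≤s z≤n))) (edgeColors j A a (suc b) bound (s≤s z≤n))
edgeColors-suc j B (suc a) b bound =
  trans (foldColor-inside j false _ (Inside-edgeMidpoint j B (suc a) b bound (s≤s z≤n))) (edgeColors j B (suc a) b bound (s≤s z≤n))

foldColor-edgeMidpoint : ∀ j t a b k → a ℕ.+ b ℕ.< 2 ^ j → Inside (negTwo^ k) (edgeMidpoint j t a b) →
                         foldColor allUp k false (edgeMidpoint j t a b) ≡ just (foldedPattern j t a b)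
foldColor-edgeMidpoint j t a b k bound inside =
  trans (foldColor-stable k (suc j) false _ (edgeMidpoint-InPlane j t a b) inside (Inside-edgeMidpoint-suc j t a b bound))
        (edgeColors-suc j t a b bound)

opp-midColor-flipO : ∀ o → opp (midColor (flipO o)) ≡ midColor o
opp-midColor-flipO positive = refl
opp-midColor-flipO negative = refl

opp-Fplus-flipO : ∀ o c t a b → opp (Fplus (flipO o) (λ t a b → opp (c t a b)) t a b) ≡ Fplus o c t a b
opp-Fplus-flipO o c A a b with even b | even a
... | true  | _     = opp-involutive (opp (c A (half a) (half b)))
... | false | true  = opp-midColor-flipO o
... | false | false = opp-midColor-flipO (flipO o)
opp-Fplus-flipO o c B a b with even a | even b
... | true  | _     = opp-involutive (opp (c B (half a) (half b)))
... | false | true  = opp-midColor-flipO o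
... | false | false = opp-midColor-flipO (flipO o)
opp-Fplus-flipO o c C a b with even (a ℕ.+ b) | even a
... | false | _     = opp-involutive (opp (c C (half a) (half b)))
... | true  | true  = opp-midColor-flipO o
... | true  | false = opp-midColor-flipO (flipO o)

foldedPattern-suc-suc : ∀ m t a b → foldedPattern (suc (suc m)) t a b ≡ FP (levelOrient m) (foldedPattern m) t a b
foldedPattern-suc-suc m = opp-Fplus-flipO (levelOrient m) (Fplus (levelOrient m) (foldedPattern m))

Fplus-cong : ∀ o {c c′ : Coloring} → (∀ t a b → c t a b ≡ c′ t a b) → ∀ t a b → Fplus o c t a b ≡ Fplus o c′ t a b
Fplus-cong o c≗c′ A a b rewrite c≗c′ A (half a) (half b) = refl
Fplus-cong o c≗c′ B a b rewrite c≗c′ B (half a) (half b) = refl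
Fplus-cong o c≗c′ C a b rewrite c≗c′ C (half a) (half b) = refl

levelOrient-double : ∀ n → levelOrient (n ℕ.+ n) ≡ positive
levelOrient-double zero = refl
levelOrient-double (suc n) rewrite ℕₚ.+-suc n n | levelOrient-double n = refl

foldedPattern-FPⁿσ : ∀ n t a b → foldedPattern (n ℕ.+ n) t a b ≡ FPⁿσ n t a b
foldedPattern-FPⁿσ zero t a b = refl
foldedPattern-FPⁿσ (suc n) t a b rewrite ℕₚ.+-suc n n =
  trans (foldedPattern-suc-suc (n ℕ.+ n) t a b)
        (trans (cong (λ o → FP o (foldedPattern (n ℕ.+ n)) t a b) (levelOrient-double n))
               (Fplus-cong positive (Fplus-cong positive (foldedPattern-FPⁿσ n)) t a b))

negOne^-double : ∀ n → negOne^ (n ℕ.+ n) ≡ + 1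
negOne^-double zero = refl
negOne^-double (suc n) rewrite ℕₚ.+-suc n n | negOne^-double n = refl

negTwo^-double : ∀ n → negTwo^ (n ℕ.+ n) ≡ + 3 * r n + + 1
negTwo^-double zero = refl
negTwo^-double (suc n) rewrite ℕₚ.+-suc n n | negTwo^-double n = identity (r n)
  where
  identity : ∀ r → - + 2 * (- + 2 * (+ 3 * r + + 1)) ≡ + 3 * (+ 4 * r + + 1) + + 1
  identity = solve-∀

2^-double : ∀ n → 2 ^ (n ℕ.+ n) ≡ 4 ^ n
2^-double zero = refl
2^-double (suc n) rewrite ℕₚ.+-suc n n | 2^-double n = identity (4 ^ n)
  where
  identity : ∀ x → 2 ℕ.* (2 ℕ.* x) ≡ 4 ℕ.* x
  identity = ℕ-Solver.solve-∀

-- The doubled midpoint of the grid edge from vert p q to vert p′ q′ is the point of (3r + 1)T₀ with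
-- intrinsic coordinates U/6 = r - (p + p′)/2, V/6 = r - (q + q′)/2.
vert⊕vert : ∀ r p q p′ q′ U V → + 3 * (p + p′) ≡ + 6 * r - U → + 3 * (q + q′) ≡ + 6 * r - V →
            vert p q ⊕ vert p′ q′ ≡ triPoint (+ 3 * r + + 1) (+ 1) U V
vert⊕vert r p q p′ q′ U V p≡ q≡ = triple-≡ (side r p p′ U p≡) (side r q q′ V q≡) (third r p q p′ q′ U V p≡ q≡)
  where
  side : ∀ r p p′ U → + 3 * (p + p′) ≡ + 6 * r - U →
         (+ 1 + + 3 * p) + (+ 1 + + 3 * p′) ≡ + 2 * (+ 3 * r + + 1) - + 1 * U
  side r p p′ U p≡ = trans (identity₁ p p′) (trans (cong (λ w → + 2 + w) p≡) (identity₂ r U))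
    where
    identity₁ : ∀ p p′ → (+ 1 + + 3 * p) + (+ 1 + + 3 * p′) ≡ + 2 + + 3 * (p + p′)
    identity₁ = solve-∀
    identity₂ : ∀ r U → + 2 + (+ 6 * r - U) ≡ + 2 * (+ 3 * r + + 1) - + 1 * U
    identity₂ = solve-∀
  third : ∀ r p q p′ q′ U V → + 3 * (p + p′) ≡ + 6 * r - U → + 3 * (q + q′) ≡ + 6 * r - V →
          (- (+ 2) - + 3 * p - + 3 * q) + (- (+ 2) - + 3 * p′ - + 3 * q′) ≡ - + 4 * (+ 3 * r + + 1) + + 1 * (U + V)
  third r p q p′ q′ U V p≡ q≡ =
    trans (identity₁ p q p′ q′) (trans (cong₂ (λ P Q → - + 4 - P - Q) p≡ q≡) (identity₂ r U V))
    where
    identity₁ : ∀ p q p′ q′ → (- (+ 2) - + 3 * p - + 3 * q) + (- (+ 2) - + 3 * p′ - + 3 * q′) ≡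
                             - + 4 - + 3 * (p + p′) - + 3 * (q + q′)
    identity₁ = solve-∀
    identity₂ : ∀ r U V → - + 4 - (+ 6 * r - U) - (+ 6 * r - V) ≡ - + 4 * (+ 3 * r + + 1) + + 1 * (U + V)
    identity₂ = solve-∀

levelPoint-double : ∀ n U V → levelPoint (n ℕ.+ n) U V ≡ triPoint (+ 3 * r n + + 1) (+ 1) U V
levelPoint-double n U V = cong₂ (λ s e → triPoint s e U V) (negTwo^-double n) (negOne^-double n)

private
  half-integral-offset : ∀ r a → + 3 * ((r - a - + 1) + ((r - a - + 1) + + 1)) ≡ + 6 * r - (+ 6 * a + + 3)
  half-integral-offset = solve-∀
  half-integral-offset′ : ∀ r a → + 3 * ((r - a) + ((r - a) - + 1)) ≡ + 6 * r - (+ 6 * a + + 3)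
  half-integral-offset′ = solve-∀
  integral-offset : ∀ r a → + 3 * ((r - a) + (r - a)) ≡ + 6 * r - (+ 6 * a + 0ℤ)
  integral-offset = solve-∀

mid-place : ∀ n t a b → mid (place n t a b) ≡ edgeMidpoint (n ℕ.+ n) t a b
mid-place n A a b =
  trans (vert⊕vert (r n) (r n - + a - + 1) (r n - + b) (r n - + a - + 1 + + 1) (r n - + b) _ _
                   (half-integral-offset (r n) (+ a)) (integral-offset (r n) (+ b)))
        (sym (levelPoint-double n _ _))
mid-place n B a b =
  trans (vert⊕vert (r n) (r n - + a) (r n - + b - + 1) (r n - + a) (r n - + b - + 1 + + 1) _ _
                   (integral-offset (r n) (+ a)) (half-integral-offset (r n) (+ b)))
        (sym (levelPoint-double n _ _))
mid-place n C a b =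
  trans (vert⊕vert (r n) (r n - + a - + 1) (r n - + b) (r n - + a - + 1 + + 1) (r n - + b - + 1) _ _
                   (half-integral-offset (r n) (+ a)) (half-integral-offset′ (r n) (+ b)))
        (sym (levelPoint-double n _ _))

foldingPattern-place : ∀ n t a b → InTri (4 ^ n) a b → ∀ k → Inside (negTwo^ k) (mid (place n t a b)) →
                       foldingPattern allUp k (place n t a b) ≡ just (FPⁿσ n t a b)
foldingPattern-place n t a b inTri k inside = begin
  foldColor allUp k false (mid (place n t a b))            ≡⟨ cong (foldColor allUp k false) (mid-place n t a b) ⟩
  foldColor allUp k false (edgeMidpoint (n ℕ.+ n) t a b)   ≡⟨ foldColor-edgeMidpoint (n ℕ.+ n) t a b k bound inside′ ⟩
  just (foldedPattern (n ℕ.+ n) t a b)                     ≡⟨ cong just (foldedPattern-FPⁿσ n t a b) ⟩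
  just (FPⁿσ n t a b)                                      ∎
  where
  open ≡-Reasoning
  bound : a ℕ.+ b ℕ.< 2 ^ (n ℕ.+ n)
  bound = subst (a ℕ.+ b ℕ.<_) (sym (2^-double n)) inTri
  inside′ : Inside (negTwo^ k) (edgeMidpoint (n ℕ.+ n) t a b)
  inside′ = subst (Inside (negTwo^ k)) (mid-place n t a b) inside

-- Interior k e only computes to Inside once the edge type, hence mid e, is known.
theorem4p2 : (n : ℕ) (t : EType) (a b : ℕ) → InTri (4 ^ n) a b →
    (k : ℕ) → Interior k (place n t a b) →
    foldingPattern allUp k (place n t a b) ≡ just (FPⁿσ n t a b)
theorem4p2 n A a b inTri k interior = foldingPattern-place n A a b inTri k interior
theorem4p2 n B a b inTri k interior = foldingPattern-place n B a b inTri k interior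
theorem4p2 n C a b inTri k interior = foldingPattern-place n C a b inTri k interior
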